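{- Suppose that $\pi=\sigma[\alpha_1,\dots,\alpha_m]$ and that $\theta$ is an interval of $\pi$ not contained in a single $\alpha_i$. Then there exist a (possibly empty) interval $[i,j]$ of indices, and (possibly empty) intervals $\gamma_{i-1}$ of $\alpha_{i-1}$ and $\gamma_{j+1}$ of $\alpha_{j+1}$, such that $\tau=\sigma([i,j])$ is an interval of $\sigma$, and the entries of $\theta$ correspond to either $\gamma_{i-1}\oplus\tau[\alpha_i,\dots,\alpha_j]\oplus\gamma_{j+1}$ or $\gamma_{i-1}\ominus\tau[\alpha_i,\dots,\alpha_j]\ominus\gamma_{j+1}$. In the first case, $\gamma_{i-1}$ may be nonempty only if $\sigma([i-1,j])$ is also an interval of $\sigma$ of the form $1\oplus\tau$ and $\gamma_{i-1}$ is a sum-suffix of $\alpha_{i-1}$, while $\gamma_{j+1}$ may be nonempty only if $\sigma([i,j+1])$ is also an interval of $\sigma$ of the form $\tau\oplus1$ and $\gamma_{j+1}$ is a sum-prefix of $\alpha_{j+1}$. In the second case, $\gamma_{i-1}$ may be nonempty only if $\sigma([i-1,j])$ is an interval of $\sigma$ of the form $1\ominus\tau$ and $\gamma_{i-1}$ is a skew-suffix of $\alpha_{i-1}$, while $\gamma_{j+1}$ may be nonempty only if $\sigma([i,j+1])$ is an interval of $\sigma$ of the form $\tau\ominus1$ and $\gamma_{j+1}$ is a skew-prefix of $\alpha_{j+1}$.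
   Context: An interval of a permutation $\pi$ is a set of contiguous indices $[a,b]=\{a,\dots,b\}$ such that the set of values $\pi([a,b])$ is also contiguous; we identify an interval with the pattern it forms. Given $\sigma$ of length $m$ and nonempty $\alpha_1,\dots,\alpha_m$, the inflation $\sigma[\alpha_1,\dots,\alpha_m]$ is obtained by replacing each entry $\sigma(i)$ by an interval order isomorphic to $\alpha_i$. The sum is $\alpha\oplus\beta=12[\alpha,\beta]$ and the skew sum is $\alpha\ominus\beta=21[\alpha,\beta]$. A permutation is sum indecomposable if it is not a sum of two nonempty permutations; every $\pi$ is uniquely $\alpha_1\oplus\cdots\oplus\alpha_k$ with the $\alpha_i$ sum indecomposable (its sum components), and the sum-prefixes and sum-suffixes of $\pi$ are $\alpha_1\oplus\cdots\oplus\alpha_i$ and $\alpha_i\oplus\cdots\oplus\alpha_k$; skew components, skew-prefixes and skew-suffixes are defined analogously using $\ominus$. -}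

module Defs where

open import Data.Nat using (ℕ; zero; suc; _+_; _∸_; _≤_; _<_; _<ᵇ_; _<?_)
open import Data.Bool using (if_then_else_)
open import Data.List using (List; []; _∷_; _++_; map; length; take; drop; filter; concat; zipWith; upTo)
open import Data.Nat.ListAction using (sum)
open import Data.List.Membership.Propositional using (_∈_)
open import Data.List.Relation.Binary.Permutation.Propositional using (_↭_)
open import Data.Product using (Σ; _×_; _,_)
open import Data.Sum using (_⊎_)
open import Relation.Binary.PropositionalEquality using (_≡_)

-- Permutations in one-line notation, 0-based values: a list that is a
-- rearrangement of 0,1,...,n-1.
IsPerm : List ℕ → Set
IsPerm xs = xs ↭ upTo (length xs)

-- Standardisation (the pattern formed by a list of distinct naturals):
-- each entry is replaced by the number of entries smaller than it.
std : List ℕ → List ℕ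
std xs = map (λ x → length (filter (_<? x) xs)) xs

slice : List ℕ → ℕ → ℕ → List ℕ
slice xs s l = take l (drop s xs)

Contig : List ℕ → Set
Contig ys = ∀ {x y z} → x ∈ ys → z ∈ ys → x ≤ y → y ≤ z → y ∈ ys

-- The index set [s, s+l-1] (possibly empty when l = 0) is an interval of xs
IsInterval : List ℕ → ℕ → ℕ → Set
IsInterval xs s l = (s + l ≤ length xs) × Contig (slice xs s l)

_⊕_ : List ℕ → List ℕ → List ℕ
α ⊕ β = α ++ map (length α +_) β

_⊖_ : List ℕ → List ℕ → List ℕ
α ⊖ β = map (length β +_) α ++ β

infixl 6 _⊕_ _⊖_

-- inflation σ[α₁,…,α_m]: block k is α_k shifted by the total size of the
-- blocks α_l with σ(l) < σ(k).
inflate : List ℕ → List (List ℕ) → List ℕ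
inflate σ αs = concat (zipWith (λ s α → map (off s +_) α) σ αs)
  where
  off : ℕ → ℕ
  off s = sum (zipWith (λ r α → if r <ᵇ s then length α else 0) σ αs)

-- k-th block (0-based), default [] if out of range
blk : List (List ℕ) → ℕ → List ℕ
blk []       _       = []
blk (α ∷ αs) zero    = α
blk (α ∷ αs) (suc k) = blk αs k

start : List (List ℕ) → ℕ → ℕ
start αs k = sum (map length (take k αs))

InRange : ℕ → ℕ → ℕ → Set
InRange lo len p = (lo ≤ p) × (p < lo + len)

-- The entries of α at positions c,…,c+l-1 form a sum-suffix / sum-prefix /
-- skew-suffix / skew-prefix of α (i.e. α = β ⊕ γ with γ these entries, etc.)
SumSuffixAt : List ℕ → ℕ → ℕ → Set
SumSuffixAt α c l = (c + l ≡ length α) × (α ≡ std (take c α) ⊕ std (drop c α))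

SumPrefixAt : List ℕ → ℕ → ℕ → Set
SumPrefixAt α c l = (c ≡ 0) × (α ≡ std (take l α) ⊕ std (drop l α))

SkewSuffixAt : List ℕ → ℕ → ℕ → Set
SkewSuffixAt α c l = (c + l ≡ length α) × (α ≡ std (take c α) ⊖ std (drop c α))

SkewPrefixAt : List ℕ → ℕ → ℕ → Set
SkewPrefixAt α c l = (c ≡ 0) × (α ≡ std (take l α) ⊖ std (drop l α))

-- Data of the conclusion (0-based block indices):
--   [i, j] = blocks i, …, i+t-1 (empty if t = 0);  τ = σ([i,j]);
--   γ_{i-1} = entries c … c+l-1 of block i-1 (empty if l = 0);
--   γ_{j+1} = entries c' … c'+l'-1 of block i+t (empty if l' = 0).
-- The "sum case" of the conclusion for θ = positions a … a+n-1 of π.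
SumCase : List ℕ → List (List ℕ) → ℕ → ℕ → ℕ → ℕ → ℕ → ℕ → ℕ → ℕ → Set
SumCase σ αs a n i t c l c' l' =
  let π  = inflate σ αs
      τ  = std (slice σ i t)
      γL = slice (blk αs (i ∸ 1)) c l
      γR = slice (blk αs (i + t)) c' l'
  in (std (slice π a n) ≡ std γL ⊕ inflate τ (take t (drop i αs)) ⊕ std γR)
   × (0 < l → IsInterval σ (i ∸ 1) (suc t)
              × (std (slice σ (i ∸ 1) (suc t)) ≡ (0 ∷ []) ⊕ τ)
              × SumSuffixAt (blk αs (i ∸ 1)) c l)
   × (0 < l' → IsInterval σ i (suc t)
              × (std (slice σ i (suc t)) ≡ τ ⊕ (0 ∷ []))
              × SumPrefixAt (blk αs (i + t)) c' l')

SkewCase : List ℕ → List (List ℕ) → ℕ → ℕ → ℕ → ℕ → ℕ → ℕ → ℕ → ℕ → Set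
SkewCase σ αs a n i t c l c' l' =
  let π  = inflate σ αs
      τ  = std (slice σ i t)
      γL = slice (blk αs (i ∸ 1)) c l
      γR = slice (blk αs (i + t)) c' l'
  in (std (slice π a n) ≡ std γL ⊖ inflate τ (take t (drop i αs)) ⊖ std γR)
   × (0 < l → IsInterval σ (i ∸ 1) (suc t)
              × (std (slice σ (i ∸ 1) (suc t)) ≡ (0 ∷ []) ⊖ τ)
              × SkewSuffixAt (blk αs (i ∸ 1)) c l)
   × (0 < l' → IsInterval σ i (suc t)
              × (std (slice σ i (suc t)) ≡ τ ⊖ (0 ∷ []))
              × SkewPrefixAt (blk αs (i + t)) c' l')

module Submission where

-- Write θ = positions a … a+n-1 of π, let k₀ be the block containing its
-- first entry and k₁ the block containing its last one (k₀ < k₁ since θ is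
-- not inside one block).  Then θ consists of a (possibly empty) final part
-- γ_L of block k₀, the full blocks i … i+t-1 strictly between, and a
-- (possibly empty) initial part γ_R of block k₁.  Since the values of θ are
-- contiguous and the blocks of π are placed according to σ, any block whose
-- values lie between two values of θ lies in θ; this "convexity" gives that
-- σ([i, i+t-1]) is an interval of σ.  Comparing σ(k₀) with σ(k₁) fixes a
-- direction (ascending: sum case, descending: skew case); convexity then
-- shows that γ_L lies entirely before (resp. after) everything else of θ, and
-- the rest of block k₀ entirely on the other side, and dually for γ_R.  These
-- orderings turn into the sum/skew decompositions through the basic fact
-- std (xs ++ ys) = std xs ⊕ std ys (resp. ⊖) when xs lies below (above) ys,
-- together with the fact that the pattern of a run of consecutive blocks of
-- an inflation is the inflation of the corresponding pattern of σ.

open import Defs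
open import Data.Nat using (ℕ; zero; suc; _+_; _∸_; _⊓_; _≤_; _<_; _<?_; _≤?_; _≟_; z≤n; s≤s; _<ᵇ_)
open import Data.Nat.Properties
open import Data.Nat.ListAction using (sum)
open import Data.Bool using (true; false; if_then_else_; T)
open import Data.Unit using (tt)
open import Data.List using (List; []; _∷_; _++_; map; length; take; drop; filter; concat; zipWith; upTo)
open import Data.List.Properties
  using (length-map; length-++; map-++; map-∘; map-id; upTo-∷ʳ; length-upTo; take-map; drop-map;
         take-all; length-take; length-drop; take++drop≡id; ++-assoc; filter-accept; filter-reject;
         length-zipWith)
open import Data.List.Membership.Propositional using (_∈_)
open import Data.List.Membership.Propositional.Properties using (∈-upTo⁺; ∈-upTo⁻; ∈-map⁻; ∈-++⁻)
open import Data.List.Relation.Unary.Any using (here; there)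
open import Data.List.Relation.Unary.All using (All; []; _∷_)
import Data.List.Relation.Unary.All as All
open import Data.List.Relation.Unary.AllPairs using (AllPairs; []; _∷_)
open import Data.List.Relation.Unary.Unique.Propositional.Properties using (upTo⁺)
open import Data.List.Relation.Binary.Permutation.Propositional using (↭-sym; ↭⇒↭ₛ)
open import Data.List.Relation.Binary.Permutation.Propositional.Properties using (↭-length; ∈-resp-↭; filter-↭)
open import Data.List.Relation.Binary.Permutation.Setoid.Properties using (Unique-resp-↭)
open import Data.Product using (Σ; _×_; _,_; proj₁; proj₂)
open import Data.Sum using (_⊎_; inj₁; inj₂)
open import Data.Empty using (⊥; ⊥-elim)
open import Relation.Nullary using (¬_; yes; no)
open import Relation.Binary.Definitions using (tri<; tri≈; tri>)
open import Relation.Binary.PropositionalEquality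
open import Relation.Binary.PropositionalEquality.Properties using (setoid)

-- Positional lookup: xs ! p is the entry of xs at position p (0-based), a
-- total function (default 0) that is only ever used at positions in range.
infixl 9 _!_
_!_ : List ℕ → ℕ → ℕ
[] ! _ = 0
(x ∷ xs) ! zero = x
(x ∷ xs) ! suc p = xs ! p

!-map : (f : ℕ → ℕ) (xs : List ℕ) (p : ℕ) → p < length xs → map f xs ! p ≡ f (xs ! p)
!-map f (x ∷ xs) zero h = refl
!-map f (x ∷ xs) (suc p) (s≤s h) = !-map f xs p h

!-++ˡ : (xs ys : List ℕ) (p : ℕ) → p < length xs → (xs ++ ys) ! p ≡ xs ! p
!-++ˡ (x ∷ xs) ys zero h = refl
!-++ˡ (x ∷ xs) ys (suc p) (s≤s h) = !-++ˡ xs ys p h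

!-++ʳ : (xs ys : List ℕ) (p : ℕ) → (xs ++ ys) ! (length xs + p) ≡ ys ! p
!-++ʳ [] ys p = refl
!-++ʳ (x ∷ xs) ys p = !-++ʳ xs ys p

!-drop : (s : ℕ) (xs : List ℕ) (p : ℕ) → drop s xs ! p ≡ xs ! (s + p)
!-drop zero xs p = refl
!-drop (suc s) [] p = refl
!-drop (suc s) (x ∷ xs) p = !-drop s xs p

!-take : (l : ℕ) (xs : List ℕ) (p : ℕ) → p < l → take l xs ! p ≡ xs ! p
!-take (suc l) [] p h = refl
!-take (suc l) (x ∷ xs) zero h = refl
!-take (suc l) (x ∷ xs) (suc p) (s≤s h) = !-take l xs p h

∈⇒index : ∀ {x} (xs : List ℕ) → x ∈ xs → Σ ℕ λ p → (p < length xs) × (xs ! p ≡ x)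
∈⇒index (y ∷ xs) (here refl) = 0 , s≤s z≤n , refl
∈⇒index (y ∷ xs) (there h) with ∈⇒index xs h
... | p , lt , eq = suc p , s≤s lt , eq

index⇒∈ : (xs : List ℕ) (p : ℕ) → p < length xs → xs ! p ∈ xs
index⇒∈ (x ∷ xs) zero h = here refl
index⇒∈ (x ∷ xs) (suc p) (s≤s h) = there (index⇒∈ xs p h)

!-ext : (xs ys : List ℕ) → length xs ≡ length ys → (∀ p → p < length xs → xs ! p ≡ ys ! p) → xs ≡ ys
!-ext [] [] e h = refl
!-ext (x ∷ xs) (y ∷ ys) e h =
  cong₂ _∷_ (h 0 (s≤s z≤n)) (!-ext xs ys (suc-injective e) (λ p lt → h (suc p) (s≤s lt)))

∈-drop⁻ : ∀ {x} c (xs : List ℕ) → x ∈ drop c xs → Σ ℕ λ p → (c + p < length xs) × (xs ! (c + p) ≡ x)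
∈-drop⁻ zero xs m = ∈⇒index xs m
∈-drop⁻ (suc c) (y ∷ xs) m with ∈-drop⁻ c xs m
... | p , lt , e = p , s≤s lt , e

length-take-≤ : ∀ {A : Set} (l : ℕ) (xs : List A) → l ≤ length xs → length (take l xs) ≡ l
length-take-≤ l xs h = trans (length-take l xs) (m≤n⇒m⊓n≡m h)

length-take-drop : ∀ {A : Set} (xs : List A) (s l : ℕ) → s + l ≤ length xs → length (take l (drop s xs)) ≡ l
length-take-drop xs s l h = length-take-≤ l (drop s xs)
  (subst (l ≤_) (sym (length-drop s xs)) (subst (_≤ length xs ∸ s) (m+n∸m≡n s l) (∸-monoˡ-≤ s h)))

length-slice : (xs : List ℕ) (s l : ℕ) → s + l ≤ length xs → length (slice xs s l) ≡ l
length-slice = length-take-drop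

!-slice : (xs : List ℕ) (s l p : ℕ) → p < l → slice xs s l ! p ≡ xs ! (s + p)
!-slice xs s l p h = trans (!-take l (drop s xs) p h) (!-drop s xs p)

∈-slice⁻ : ∀ {x} (xs : List ℕ) (s l : ℕ) → s + l ≤ length xs → x ∈ slice xs s l →
  Σ ℕ λ p → (p < l) × (s + p < length xs) × (xs ! (s + p) ≡ x)
∈-slice⁻ xs s l b h with ∈⇒index (slice xs s l) h
... | p , lt , eq = p , pl , <-≤-trans (+-monoʳ-< s pl) b , trans (sym (!-slice xs s l p pl)) eq
  where
  pl : p < l
  pl = subst (p <_) (length-slice xs s l b) lt

∈-slice⁺ : (xs : List ℕ) (s l p : ℕ) → s + l ≤ length xs → p < l → xs ! (s + p) ∈ slice xs s l
∈-slice⁺ xs s l p b pl = subst (_∈ slice xs s l) (!-slice xs s l p pl)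
  (index⇒∈ (slice xs s l) p (subst (p <_) (sym (length-slice xs s l b)) pl))

∈-slice⁺′ : (xs : List ℕ) (s l q : ℕ) → s + l ≤ length xs → s ≤ q → q < s + l → xs ! q ∈ slice xs s l
∈-slice⁺′ xs s l q b sq ql = subst (λ w → xs ! w ∈ slice xs s l) (m+[n∸m]≡n sq)
  (∈-slice⁺ xs s l (q ∸ s) b (+-cancelˡ-< s _ _ (subst (_< s + l) (sym (m+[n∸m]≡n sq)) ql)))

drop-cons : ∀ k (xs : List ℕ) → k < length xs → drop k xs ≡ (xs ! k) ∷ drop (suc k) xs
drop-cons zero (x ∷ xs) lt = refl
drop-cons (suc k) (x ∷ xs) (s≤s lt) = drop-cons k xs lt

slice-cons : ∀ (xs : List ℕ) k t → k < length xs → slice xs k (suc t) ≡ (xs ! k) ∷ slice xs (suc k) t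
slice-cons xs k t lt = cong (take (suc t)) (drop-cons k xs lt)

take-snoc : ∀ (ys : List ℕ) t → t < length ys → take (suc t) ys ≡ take t ys ++ (ys ! t ∷ [])
take-snoc (y ∷ ys) zero lt = refl
take-snoc (y ∷ ys) (suc t) (s≤s lt) = cong (y ∷_) (take-snoc ys t lt)

slice-snoc : ∀ (xs : List ℕ) i t → i + t < length xs → slice xs i (suc t) ≡ slice xs i t ++ (xs ! (i + t) ∷ [])
slice-snoc xs i t lt = trans (take-snoc (drop i xs) t lt') (cong (λ w → slice xs i t ++ (w ∷ [])) (!-drop i xs t))
  where
  lt' : t < length (drop i xs)
  lt' = subst (t <_) (sym (length-drop i xs)) (subst (_< length xs ∸ i) (m+n∸m≡n i t) (∸-monoˡ-< lt (m≤m+n i t)))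

cnt : List ℕ → ℕ → ℕ
cnt xs v = length (filter (_<? v) xs)

cnt-yes : ∀ x xs v → x < v → cnt (x ∷ xs) v ≡ suc (cnt xs v)
cnt-yes x xs v h = cong length (filter-accept (_<? v) h)

cnt-no : ∀ x xs v → ¬ (x < v) → cnt (x ∷ xs) v ≡ cnt xs v
cnt-no x xs v h = cong length (filter-reject (_<? v) h)

cnt-++ : ∀ xs ys v → cnt (xs ++ ys) v ≡ cnt xs v + cnt ys v
cnt-++ [] ys v = refl
cnt-++ (x ∷ xs) ys v with x <? v
... | yes h = trans (cnt-yes x (xs ++ ys) v h) (trans (cong suc (cnt-++ xs ys v)) (cong (_+ cnt ys v) (sym (cnt-yes x xs v h))))
... | no h = trans (cnt-no x (xs ++ ys) v h) (trans (cnt-++ xs ys v) (cong (_+ cnt ys v) (sym (cnt-no x xs v h))))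

cnt-all : ∀ xs v → (∀ {x} → x ∈ xs → x < v) → cnt xs v ≡ length xs
cnt-all [] v h = refl
cnt-all (x ∷ xs) v h = trans (cnt-yes x xs v (h (here refl))) (cong suc (cnt-all xs v (λ z → h (there z))))

cnt-none : ∀ xs v → (∀ {x} → x ∈ xs → v ≤ x) → cnt xs v ≡ 0
cnt-none [] v h = refl
cnt-none (x ∷ xs) v h = trans (cnt-no x xs v (λ lt → <⇒≱ lt (h (here refl)))) (cnt-none xs v (λ z → h (there z)))

cnt-shift : ∀ k xs v → cnt (map (k +_) xs) (k + v) ≡ cnt xs v
cnt-shift k [] v = refl
cnt-shift k (x ∷ xs) v with x <? v
... | yes h = trans (cnt-yes (k + x) (map (k +_) xs) (k + v) (+-monoʳ-< k h)) (trans (cong suc (cnt-shift k xs v)) (sym (cnt-yes x xs v h)))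
... | no h = trans (cnt-no (k + x) (map (k +_) xs) (k + v) (λ lt → h (+-cancelˡ-< k x v lt))) (trans (cnt-shift k xs v) (sym (cnt-no x xs v h)))

cnt-mono : ∀ xs {u v} → u ≤ v → cnt xs u ≤ cnt xs v
cnt-mono [] h = z≤n
cnt-mono (x ∷ xs) {u} {v} h with x <? u
... | yes lt = subst₂ _≤_ (sym (cnt-yes x xs u lt)) (sym (cnt-yes x xs v (<-≤-trans lt h))) (s≤s (cnt-mono xs h))
... | no nu with x <? v
...   | yes lv = subst₂ _≤_ (sym (cnt-no x xs u nu)) (sym (cnt-yes x xs v lv)) (m≤n⇒m≤1+n (cnt-mono xs h))
...   | no nv = subst₂ _≤_ (sym (cnt-no x xs u nu)) (sym (cnt-no x xs v nv)) (cnt-mono xs h)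

cnt-strict : ∀ xs {u v} → u < v → u ∈ xs → cnt xs u < cnt xs v
cnt-strict (x ∷ xs) {u} {v} h (here refl) =
  subst (_ <_) (sym (cnt-yes x xs v h))
    (s≤s (≤-trans (≤-reflexive (cnt-no x xs x (<-irrefl refl))) (cnt-mono xs (<⇒≤ h))))
cnt-strict (x ∷ xs) {u} {v} h (there m) with x <? u
... | yes lt = subst₂ _<_ (sym (cnt-yes x xs u lt)) (sym (cnt-yes x xs v (<-trans lt h))) (s≤s (cnt-strict xs h m))
... | no nu with x <? v
...   | yes lv = subst₂ _<_ (sym (cnt-no x xs u nu)) (sym (cnt-yes x xs v lv)) (m≤n⇒m≤1+n (cnt-strict xs h m))
...   | no nv = subst₂ _<_ (sym (cnt-no x xs u nu)) (sym (cnt-no x xs v nv)) (cnt-strict xs h m)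

cnt-upTo : ∀ n v → v ≤ n → cnt (upTo n) v ≡ v
cnt-upTo zero zero h = refl
cnt-upTo (suc n) v h = begin
    cnt (upTo (suc n)) v
  ≡⟨ cong (λ z → cnt z v) (sym (upTo-∷ʳ n)) ⟩
    cnt (upTo n ++ (n ∷ [])) v
  ≡⟨ cnt-++ (upTo n) (n ∷ []) v ⟩
    cnt (upTo n) v + cnt (n ∷ []) v
  ≡⟨ last (m≤n⇒m<n∨m≡n h) ⟩
    v ∎
  where
  open ≡-Reasoning
  last : v < suc n ⊎ v ≡ suc n → cnt (upTo n) v + cnt (n ∷ []) v ≡ v
  last (inj₁ (s≤s lt)) = trans (cong₂ _+_ (cnt-upTo n v lt) (cnt-no n [] v (λ q → <⇒≱ q lt))) (+-identityʳ v)
  last (inj₂ refl) = trans (cong₂ _+_ (trans (cnt-all (upTo n) (suc n) (λ m → m≤n⇒m≤1+n (∈-upTo⁻ m))) (length-upTo n))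
                                      (cnt-yes n [] (suc n) ≤-refl)) (+-comm n 1)

length-std : ∀ xs → length (std xs) ≡ length xs
length-std xs = length-map _ xs

!-std : ∀ xs p → p < length xs → std xs ! p ≡ cnt xs (xs ! p)
!-std xs p h = !-map (cnt xs) xs p h

map-cong∈ : ∀ {f g : ℕ → ℕ} (xs : List ℕ) → (∀ {x} → x ∈ xs → f x ≡ g x) → map f xs ≡ map g xs
map-cong∈ [] h = refl
map-cong∈ (x ∷ xs) h = cong₂ _∷_ (h (here refl)) (map-cong∈ xs (λ z → h (there z)))

std-shift : ∀ k xs → std (map (k +_) xs) ≡ std xs
std-shift k xs = trans (sym (map-∘ xs)) (map-cong∈ xs (λ {x} _ → cnt-shift k xs x))

std-sum : ∀ xs ys → (∀ {x y} → x ∈ xs → y ∈ ys → x < y) → std (xs ++ ys) ≡ std xs ⊕ std ys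
std-sum xs ys h = begin
    map (cnt (xs ++ ys)) (xs ++ ys)
  ≡⟨ map-++ (cnt (xs ++ ys)) xs ys ⟩
    map (cnt (xs ++ ys)) xs ++ map (cnt (xs ++ ys)) ys
  ≡⟨ cong₂ _++_ (map-cong∈ xs below) (trans (map-cong∈ ys above) (map-∘ ys)) ⟩
    std xs ⊕ std ys ∎
  where
  open ≡-Reasoning
  below : ∀ {x} → x ∈ xs → cnt (xs ++ ys) x ≡ cnt xs x
  below {x} m = trans (cnt-++ xs ys x) (trans (cong (cnt xs x +_) (cnt-none ys x (λ m' → <⇒≤ (h m m')))) (+-identityʳ _))
  above : ∀ {y} → y ∈ ys → cnt (xs ++ ys) y ≡ length (std xs) + cnt ys y
  above {y} m = trans (cnt-++ xs ys y) (cong (_+ cnt ys y) (trans (cnt-all xs y (λ m' → h m' m)) (sym (length-std xs))))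

std-skew : ∀ xs ys → (∀ {x y} → x ∈ xs → y ∈ ys → y < x) → std (xs ++ ys) ≡ std xs ⊖ std ys
std-skew xs ys h = begin
    map (cnt (xs ++ ys)) (xs ++ ys)
  ≡⟨ map-++ (cnt (xs ++ ys)) xs ys ⟩
    map (cnt (xs ++ ys)) xs ++ map (cnt (xs ++ ys)) ys
  ≡⟨ cong₂ _++_ (trans (map-cong∈ xs above) (map-∘ xs)) (map-cong∈ ys below) ⟩
    std xs ⊖ std ys ∎
  where
  open ≡-Reasoning
  above : ∀ {x} → x ∈ xs → cnt (xs ++ ys) x ≡ length (std ys) + cnt xs x
  above {x} m = trans (cnt-++ xs ys x) (trans (+-comm (cnt xs x) (cnt ys x)) (cong (_+ cnt xs x) (trans (cnt-all ys x (λ m' → h m m')) (sym (length-std ys)))))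
  below : ∀ {y} → y ∈ ys → cnt (xs ++ ys) y ≡ cnt ys y
  below {y} m = trans (cnt-++ xs ys y) (cong (_+ cnt ys y) (cnt-none xs y (λ m' → <⇒≤ (h m' m))))

std-single : ∀ x → std (x ∷ []) ≡ 0 ∷ []
std-single x = cong (_∷ []) (cnt-no x [] x (<-irrefl refl))

-- Directions.  The sum and skew cases of the proposition are the same
-- argument read with the value order reversed; a direction records which.

data Direction : Set where
  ascending descending : Direction

infix 4 _≺⟨_⟩_
_≺⟨_⟩_ : ℕ → Direction → ℕ → Set
x ≺⟨ ascending ⟩ y = x < y
x ≺⟨ descending ⟩ y = y < x

infixl 6 _⊙⟨_⟩_
_⊙⟨_⟩_ : List ℕ → Direction → List ℕ → List ℕ
α ⊙⟨ ascending ⟩ β = α ⊕ β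
α ⊙⟨ descending ⟩ β = α ⊖ β

std-join : ∀ d xs ys → (∀ {x y} → x ∈ xs → y ∈ ys → x ≺⟨ d ⟩ y) → std (xs ++ ys) ≡ std xs ⊙⟨ d ⟩ std ys
std-join ascending = std-sum
std-join descending = std-skew

≺-cancel : ∀ d o {x y} → o + x ≺⟨ d ⟩ o + y → x ≺⟨ d ⟩ y
≺-cancel ascending o h = +-cancelˡ-< o _ _ h
≺-cancel descending o h = +-cancelˡ-< o _ _ h

std-cons : ∀ d x ys → (∀ {y} → y ∈ ys → x ≺⟨ d ⟩ y) → std (x ∷ ys) ≡ (0 ∷ []) ⊙⟨ d ⟩ std ys
std-cons d x ys h = trans (std-join d (x ∷ []) ys (λ { (here refl) my → h my })) (cong (λ u → u ⊙⟨ d ⟩ std ys) (std-single x))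

std-snoc : ∀ d xs y → (∀ {x} → x ∈ xs → x ≺⟨ d ⟩ y) → std (xs ++ (y ∷ [])) ≡ std xs ⊙⟨ d ⟩ (0 ∷ [])
std-snoc d xs y h = trans (std-join d xs (y ∷ []) (λ { mx (here refl) → h mx })) (cong (λ u → std xs ⊙⟨ d ⟩ u) (std-single y))

perm-∈ : ∀ {xs x} → IsPerm xs → x ∈ xs → x < length xs
perm-∈ P m = ∈-upTo⁻ (∈-resp-↭ P m)

perm-< : ∀ {xs} p → IsPerm xs → p < length xs → xs ! p < length xs
perm-< {xs} p P lt = perm-∈ P (index⇒∈ xs p lt)

perm-surj : ∀ {xs} y → IsPerm xs → y < length xs → Σ ℕ λ p → (p < length xs) × (xs ! p ≡ y)
perm-surj {xs} y P lt = ∈⇒index xs (∈-resp-↭ (↭-sym P) (∈-upTo⁺ lt))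

perm-cnt : ∀ {xs x} → IsPerm xs → x ∈ xs → cnt xs x ≡ x
perm-cnt {xs} {x} P m = trans (↭-length (filter-↭ (_<? x) P)) (cnt-upTo (length xs) x (<⇒≤ (perm-∈ P m)))

std-perm : ∀ {xs} → IsPerm xs → std xs ≡ xs
std-perm {xs} P = trans (map-cong∈ xs (λ m → perm-cnt P m)) (map-id xs)

split-pattern : ∀ d (α : List ℕ) c → IsPerm α → c ≤ length α →
  (∀ p q → p < c → c + q < length α → α ! p ≺⟨ d ⟩ α ! (c + q)) → α ≡ std (take c α) ⊙⟨ d ⟩ std (drop c α)
split-pattern d α c P cα h = trans (sym (std-perm P)) (trans (cong std (sym (take++drop≡id c α))) (std-join d _ _ ordered))
  where
  ordered : ∀ {x y} → x ∈ take c α → y ∈ drop c α → x ≺⟨ d ⟩ y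
  ordered mx my with ∈-slice⁻ α 0 c cα mx | ∈-drop⁻ c α my
  ... | p , pc , _ , refl | q , qα , refl = h p q pc qα

Distinct : List ℕ → Set
Distinct = AllPairs (λ x y → ¬ x ≡ y)

distinct-inj : ∀ xs p q → Distinct xs → p < length xs → q < length xs → xs ! p ≡ xs ! q → p ≡ q
distinct-inj (x ∷ xs) zero zero U hp hq e = refl
distinct-inj (x ∷ xs) zero (suc q) (a ∷ U) hp (s≤s hq) e = ⊥-elim (All.lookup a (index⇒∈ xs q hq) e)
distinct-inj (x ∷ xs) (suc p) zero (a ∷ U) (s≤s hp) hq e = ⊥-elim (All.lookup a (index⇒∈ xs p hp) (sym e))
distinct-inj (x ∷ xs) (suc p) (suc q) (a ∷ U) (s≤s hp) (s≤s hq) e = cong suc (distinct-inj xs p q U hp hq e)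

perm-inj : ∀ {xs} p q → IsPerm xs → p < length xs → q < length xs → xs ! p ≡ xs ! q → p ≡ q
perm-inj {xs} p q P = distinct-inj xs p q (Unique-resp-↭ (setoid ℕ) (↭⇒↭ₛ (↭-sym P)) (upTo⁺ (length xs)))

Σ< : ℕ → (ℕ → ℕ) → ℕ
Σ< zero f = 0
Σ< (suc n) f = f 0 + Σ< n (λ k → f (suc k))

Σ-ext : ∀ n {f g : ℕ → ℕ} → (∀ k → k < n → f k ≡ g k) → Σ< n f ≡ Σ< n g
Σ-ext zero h = refl
Σ-ext (suc n) h = cong₂ _+_ (h 0 (s≤s z≤n)) (Σ-ext n (λ k lt → h (suc k) (s≤s lt)))

Σ-mono : ∀ n {f g : ℕ → ℕ} → (∀ k → k < n → f k ≤ g k) → Σ< n f ≤ Σ< n g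
Σ-mono zero h = z≤n
Σ-mono (suc n) h = +-mono-≤ (h 0 (s≤s z≤n)) (Σ-mono n (λ k lt → h (suc k) (s≤s lt)))

Σ-diff-≤ : ∀ n {f g : ℕ → ℕ} k b → k < n → (∀ k' → k' < n → ¬ k' ≡ k → f k' ≤ g k') →
  f k + b ≤ g k → Σ< n f + b ≤ Σ< n g
Σ-diff-≤ (suc n) {f} {g} zero b lt h hk =
  subst (_≤ g 0 + Σ< n (λ k → g (suc k))) (+-rearrange (f 0) b _)
    (+-mono-≤ hk (Σ-mono n (λ k' lt' → h (suc k') (s≤s lt') (λ ()))))
  where
  +-rearrange : ∀ x y z → x + y + z ≡ x + z + y
  +-rearrange x y z = trans (+-assoc x y z) (trans (cong (x +_) (+-comm y z)) (sym (+-assoc x z y)))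
Σ-diff-≤ (suc n) {f} {g} (suc k) b (s≤s lt) h hk =
  subst (_≤ g 0 + Σ< n (λ k → g (suc k))) (sym (+-assoc (f 0) _ b))
    (+-mono-≤ (h 0 (s≤s z≤n) (λ ())) (Σ-diff-≤ n k b lt (λ k' lt' ne → h (suc k') (s≤s lt') (λ e → ne (suc-injective e))) hk))

Σ-diff-≡ : ∀ n {f g : ℕ → ℕ} k b → k < n → (∀ k' → k' < n → ¬ k' ≡ k → f k' ≡ g k') →
  f k ≡ g k + b → Σ< n f ≡ Σ< n g + b
Σ-diff-≡ (suc n) {f} {g} zero b lt h hk =
  trans (cong₂ _+_ hk (Σ-ext n (λ k' lt' → h (suc k') (s≤s lt') (λ ()))))
    (trans (+-assoc (g 0) b _) (trans (cong (g 0 +_) (+-comm b _)) (sym (+-assoc (g 0) _ b))))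
Σ-diff-≡ (suc n) {f} {g} (suc k) b (s≤s lt) h hk =
  trans (cong₂ _+_ (h 0 (s≤s z≤n) (λ ())) (Σ-diff-≡ n k b lt (λ k' lt' ne → h (suc k') (s≤s lt') (λ e → ne (suc-injective e))) hk))
    (sym (+-assoc (g 0) _ b))

if-<ᵇ-yes : ∀ {A : Set} x y (a b : A) → x < y → (if x <ᵇ y then a else b) ≡ a
if-<ᵇ-yes x y a b h with x <ᵇ y | <⇒<ᵇ h
... | true | _ = refl

if-<ᵇ-no : ∀ {A : Set} x y (a b : A) → ¬ (x < y) → (if x <ᵇ y then a else b) ≡ b
if-<ᵇ-no x y a b h with x <ᵇ y in eq
... | true = ⊥-elim (h (<ᵇ⇒< x y (subst T (sym eq) tt)))
... | false = refl

length-zipWith≡ : ∀ {A B C : Set} (f : A → B → C) (xs : List A) (ys : List B) →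
  length xs ≡ length ys → length (zipWith f xs ys) ≡ length xs
length-zipWith≡ f xs ys e = trans (length-zipWith f xs ys) (trans (cong (length xs ⊓_) (sym e)) (⊓-idem _))

sum-zipWith : ∀ (h : ℕ → List ℕ → ℕ) (xs : List ℕ) (ys : List (List ℕ)) → length xs ≡ length ys →
  sum (zipWith h xs ys) ≡ Σ< (length xs) (λ k → h (xs ! k) (blk ys k))
sum-zipWith h [] [] e = refl
sum-zipWith h (x ∷ xs) (y ∷ ys) e = cong (h x y +_) (sum-zipWith h xs ys (suc-injective e))

blk-zipWith : ∀ (g : ℕ → List ℕ → List ℕ) (xs : List ℕ) (ys : List (List ℕ)) k → length xs ≡ length ys → k < length xs →
  blk (zipWith g xs ys) k ≡ g (xs ! k) (blk ys k)
blk-zipWith g (x ∷ xs) (y ∷ ys) zero e lt = refl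
blk-zipWith g (x ∷ xs) (y ∷ ys) (suc k) e (s≤s lt) = blk-zipWith g xs ys k (suc-injective e) lt

lengths-zipWith : ∀ (g : ℕ → ℕ → ℕ) (xs : List ℕ) (ys : List (List ℕ)) → length xs ≡ length ys →
  map length (zipWith (λ s α → map (g s) α) xs ys) ≡ map length ys
lengths-zipWith g [] [] e = refl
lengths-zipWith g (x ∷ xs) (y ∷ ys) e = cong₂ _∷_ (length-map (g x) y) (lengths-zipWith g xs ys (suc-injective e))

blk-drop : ∀ (Ls : List (List ℕ)) i t → blk (drop i Ls) t ≡ blk Ls (i + t)
blk-drop Ls zero t = refl
blk-drop [] (suc i) t = refl
blk-drop (L ∷ Ls) (suc i) t = blk-drop Ls i t

blk-take : ∀ (Ls : List (List ℕ)) n t → t < n → blk (take n Ls) t ≡ blk Ls t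
blk-take [] (suc n) t lt = refl
blk-take (L ∷ Ls) (suc n) zero lt = refl
blk-take (L ∷ Ls) (suc n) (suc t) (s≤s lt) = blk-take Ls n t lt

All-lookup-blk : ∀ {P : List ℕ → Set} (αs : List (List ℕ)) k → All P αs → k < length αs → P (blk αs k)
All-lookup-blk (α ∷ αs) zero (p ∷ _) _ = p
All-lookup-blk (α ∷ αs) (suc k) (_ ∷ ps) (s≤s lt) = All-lookup-blk αs k ps lt

start-suc : ∀ (Ls : List (List ℕ)) k → start Ls (suc k) ≡ start Ls k + length (blk Ls k)
start-suc [] zero = refl
start-suc [] (suc k) = refl
start-suc (L ∷ Ls) zero = +-comm (length L) 0
start-suc (L ∷ Ls) (suc k) = trans (cong (length L +_) (start-suc Ls k)) (sym (+-assoc (length L) _ _))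

start-mono : ∀ (Ls : List (List ℕ)) {k k'} → k ≤ k' → start Ls k ≤ start Ls k'
start-mono Ls {zero} h = z≤n
start-mono [] {suc k} {suc k'} h = z≤n
start-mono (L ∷ Ls) {suc k} {suc k'} (s≤s h) = +-monoʳ-≤ (length L) (start-mono Ls h)

start-drop : ∀ (Ls : List (List ℕ)) i t → start Ls (i + t) ≡ start Ls i + start (drop i Ls) t
start-drop Ls zero t = refl
start-drop [] (suc i) zero = refl
start-drop [] (suc i) (suc t) = refl
start-drop (L ∷ Ls) (suc i) t = trans (cong (length L +_) (start-drop Ls i t)) (sym (+-assoc (length L) _ _))

start-lengths : ∀ (Ls Ms : List (List ℕ)) → map length Ls ≡ map length Ms → ∀ k → start Ls k ≡ start Ms k
start-lengths Ls Ms e k = trans (cong sum (sym (take-map {f = length} k Ls)))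
  (trans (cong (λ z → sum (take k z)) e) (cong sum (take-map {f = length} k Ms)))

length-concat : ∀ (Ls : List (List ℕ)) → length (concat Ls) ≡ start Ls (length Ls)
length-concat [] = refl
length-concat (L ∷ Ls) = trans (length-++ L) (cong (length L +_) (length-concat Ls))

!-concat : ∀ (Ls : List (List ℕ)) k r → k < length Ls → r < length (blk Ls k) →
  concat Ls ! (start Ls k + r) ≡ blk Ls k ! r
!-concat (L ∷ Ls) zero r lt lr = !-++ˡ L (concat Ls) r lr
!-concat (L ∷ Ls) (suc k) r (s≤s lt) lr =
  trans (cong (concat (L ∷ Ls) !_) (+-assoc (length L) (start Ls k) r))
    (trans (!-++ʳ L (concat Ls) (start Ls k + r)) (!-concat Ls k r lt lr))

locate : ∀ (Ls : List (List ℕ)) p → p < start Ls (length Ls) →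
  Σ ℕ λ k → Σ ℕ λ r → (k < length Ls) × (r < length (blk Ls k)) × (p ≡ start Ls k + r)
locate (L ∷ Ls) p h with p <? length L
... | yes lt = 0 , p , s≤s z≤n , lt , refl
... | no ge with locate Ls (p ∸ length L) (+-cancelˡ-< (length L) _ _ (subst (_< length L + start Ls (length Ls)) (sym (m+[n∸m]≡n (≮⇒≥ ge))) h))
...   | k , r , lk , lr , e = suc k , r , s≤s lk , lr ,
        trans (sym (m+[n∸m]≡n (≮⇒≥ ge))) (trans (cong (length L +_) e) (sym (+-assoc (length L) (start Ls k) r)))

cnt-concat : ∀ (Ls : List (List ℕ)) v → cnt (concat Ls) v ≡ Σ< (length Ls) (λ k → cnt (blk Ls k) v)
cnt-concat [] v = refl
cnt-concat (L ∷ Ls) v = trans (cnt-++ L (concat Ls) v) (cong (cnt L v +_) (cnt-concat Ls v))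

take-++ˡ : ∀ (xs ys : List ℕ) r → r ≤ length xs → take r (xs ++ ys) ≡ take r xs
take-++ˡ xs ys zero h = refl
take-++ˡ (x ∷ xs) ys (suc r) (s≤s h) = cong (x ∷_) (take-++ˡ xs ys r h)

take-++ʳ : ∀ (xs ys : List ℕ) j → take (length xs + j) (xs ++ ys) ≡ xs ++ take j ys
take-++ʳ [] ys j = refl
take-++ʳ (x ∷ xs) ys j = cong (x ∷_) (take-++ʳ xs ys j)

drop-++ˡ : ∀ (xs ys : List ℕ) c → c ≤ length xs → drop c (xs ++ ys) ≡ drop c xs ++ ys
drop-++ˡ xs ys zero h = refl
drop-++ˡ (x ∷ xs) ys (suc c) (s≤s h) = drop-++ˡ xs ys c h

drop-++ʳ : ∀ (xs ys : List ℕ) j → drop (length xs + j) (xs ++ ys) ≡ drop j ys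
drop-++ʳ [] ys j = refl
drop-++ʳ (x ∷ xs) ys j = drop-++ʳ xs ys j

drop-concat0 : ∀ (Ls : List (List ℕ)) k → drop (start Ls k) (concat Ls) ≡ concat (drop k Ls)
drop-concat0 Ls zero = refl
drop-concat0 [] (suc k) = refl
drop-concat0 (L ∷ Ls) (suc k) = trans (drop-++ʳ L (concat Ls) (start Ls k)) (drop-concat0 Ls k)

drop-concat : ∀ (Ls : List (List ℕ)) k c → k < length Ls → c ≤ length (blk Ls k) →
  drop (start Ls k + c) (concat Ls) ≡ drop c (blk Ls k) ++ concat (drop (suc k) Ls)
drop-concat (L ∷ Ls) zero c lt h = drop-++ˡ L (concat Ls) c h
drop-concat (L ∷ Ls) (suc k) c (s≤s lt) h =
  trans (cong (λ z → drop z (L ++ concat Ls)) (+-assoc (length L) (start Ls k) c))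
    (trans (drop-++ʳ L (concat Ls) (start Ls k + c)) (drop-concat Ls k c lt h))

take-concat : ∀ (Ls : List (List ℕ)) t r → r ≤ length (blk Ls t) →
  take (start Ls t + r) (concat Ls) ≡ concat (take t Ls) ++ take r (blk Ls t)
take-concat [] zero zero h = refl
take-concat [] (suc t) zero h = refl
take-concat (L ∷ Ls) zero r h = take-++ˡ L (concat Ls) r h
take-concat (L ∷ Ls) (suc t) r h =
  trans (cong (λ z → take z (L ++ concat Ls)) (+-assoc (length L) (start Ls t) r))
    (trans (take-++ʳ L (concat Ls) (start Ls t + r))
      (trans (cong (L ++_) (take-concat Ls t r h)) (sym (++-assoc L _ _))))

offset : List ℕ → List (List ℕ) → ℕ → ℕ
offset σ αs s = sum (zipWith (λ r α → if r <ᵇ s then length α else 0) σ αs)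

shiftedBlocks : List ℕ → List (List ℕ) → List (List ℕ)
shiftedBlocks σ αs = zipWith (λ s α → map (offset σ αs s +_) α) σ αs

shift-below : ∀ {B O v y} → IsPerm B → O + length B ≤ v → y ∈ map (O +_) B → y < v
shift-below {B} {O} P h m with ∈-map⁻ (O +_) m
... | x , xm , refl = <-≤-trans (+-monoʳ-< O (perm-∈ P xm)) h

shift-above : ∀ {B O v y} → v ≤ O → y ∈ map (O +_) B → v ≤ y
shift-above {B} {O} h m with ∈-map⁻ (O +_) m
... | x , xm , refl = ≤-trans h (m≤m+n O x)

module Inflation (σ : List ℕ) (αs : List (List ℕ)) (E : length σ ≡ length αs) where

  offset-Σ : ∀ v → offset σ αs v ≡ Σ< (length σ) (λ r → if σ ! r <ᵇ v then length (blk αs r) else 0)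
  offset-Σ v = sum-zipWith (λ r α → if r <ᵇ v then length α else 0) σ αs E

  offset-< : ∀ k v → k < length σ → σ ! k < v → offset σ αs (σ ! k) + length (blk αs k) ≤ offset σ αs v
  offset-< k v lk lt = subst₂ _≤_ (cong (_+ length (blk αs k)) (sym (offset-Σ (σ ! k)))) (sym (offset-Σ v))
    (Σ-diff-≤ (length σ) k (length (blk αs k)) lk termwise
      (≤-reflexive (trans (cong (_+ length (blk αs k)) (if-<ᵇ-no (σ ! k) (σ ! k) _ 0 (<-irrefl refl)))
                          (sym (if-<ᵇ-yes (σ ! k) v _ 0 lt)))))
    where
    termwise : ∀ k' → k' < length σ → ¬ k' ≡ k →
      (if σ ! k' <ᵇ σ ! k then length (blk αs k') else 0) ≤ (if σ ! k' <ᵇ v then length (blk αs k') else 0)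
    termwise k' _ _ with σ ! k' <? σ ! k
    ... | yes h = ≤-reflexive (trans (if-<ᵇ-yes (σ ! k') (σ ! k) _ 0 h) (sym (if-<ᵇ-yes (σ ! k') v _ 0 (<-trans h lt))))
    ... | no h = subst (_≤ _) (sym (if-<ᵇ-no (σ ! k') (σ ! k) _ 0 h)) z≤n

  length-shiftedBlocks : length (shiftedBlocks σ αs) ≡ length σ
  length-shiftedBlocks = length-zipWith≡ _ σ αs E

  blk-shiftedBlocks : ∀ k → k < length σ → blk (shiftedBlocks σ αs) k ≡ map (offset σ αs (σ ! k) +_) (blk αs k)
  blk-shiftedBlocks k lk = blk-zipWith (λ s α → map (offset σ αs s +_) α) σ αs k E lk

  start-shiftedBlocks : ∀ k → start (shiftedBlocks σ αs) k ≡ start αs k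
  start-shiftedBlocks k = start-lengths (shiftedBlocks σ αs) αs (lengths-zipWith (λ s x → offset σ αs s + x) σ αs E) k

  length-inflate : length (inflate σ αs) ≡ start αs (length αs)
  length-inflate = trans (length-concat (shiftedBlocks σ αs))
    (trans (start-shiftedBlocks (length (shiftedBlocks σ αs))) (cong (start αs) (trans length-shiftedBlocks E)))

  !-inflate : ∀ k r → k < length σ → r < length (blk αs k) →
    inflate σ αs ! (start αs k + r) ≡ offset σ αs (σ ! k) + blk αs k ! r
  !-inflate k r lk lr =
    trans (cong (λ z → concat (shiftedBlocks σ αs) ! (z + r)) (sym (start-shiftedBlocks k)))
      (trans (!-concat (shiftedBlocks σ αs) k r (subst (k <_) (sym length-shiftedBlocks) lk) lr′)
        (trans (cong (_! r) (blk-shiftedBlocks k lk)) (!-map _ (blk αs k) r lr)))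
    where
    lr′ : r < length (blk (shiftedBlocks σ αs) k)
    lr′ = subst (λ z → r < length z) (sym (blk-shiftedBlocks k lk)) (subst (r <_) (sym (length-map _ (blk αs k))) lr)

-- The pattern of a run of consecutive blocks i, …, i+t-1 of σ[α] is the
-- inflation τ[αᵢ, …, α_{i+t-1}] of the pattern τ = std (σ([i, i+t-1])).
module BlockRun (σ : List ℕ) (αs : List (List ℕ)) (E : length σ ≡ length αs)
                (σ-perm : IsPerm σ) (α-perm : ∀ k → k < length σ → IsPerm (blk αs k))
                (i t : ℕ) (it : i + t ≤ length σ) where

  open Inflation σ αs E

  τ : List ℕ
  τ = std (slice σ i t)
  run : List (List ℕ)
  run = take t (drop i αs)
  shiftedRun : List (List ℕ)
  shiftedRun = take t (drop i (shiftedBlocks σ αs))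

  length-τ : length τ ≡ t
  length-τ = trans (length-std (slice σ i t)) (length-slice σ i t it)
  length-run : length run ≡ t
  length-run = length-take-drop αs i t (subst (i + t ≤_) E it)
  length-shiftedRun : length shiftedRun ≡ t
  length-shiftedRun = length-take-drop (shiftedBlocks σ αs) i t (subst (i + t ≤_) (sym length-shiftedBlocks) it)

  i+k<m : ∀ k → k < t → i + k < length σ
  i+k<m k lt = <-≤-trans (+-monoʳ-< i lt) it

  blk-run : ∀ k → k < t → blk run k ≡ blk αs (i + k)
  blk-run k lt = trans (blk-take (drop i αs) t k lt) (blk-drop αs i k)

  blk-shiftedRun : ∀ k → k < t → blk shiftedRun k ≡ map (offset σ αs (σ ! (i + k)) +_) (blk αs (i + k))
  blk-shiftedRun k lt = trans (blk-take (drop i (shiftedBlocks σ αs)) t k lt)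
    (trans (blk-drop (shiftedBlocks σ αs) i k) (blk-shiftedBlocks (i + k) (i+k<m k lt)))

  lengths-shiftedRun : map length shiftedRun ≡ map length run
  lengths-shiftedRun = begin
      map length (take t (drop i (shiftedBlocks σ αs)))
    ≡⟨ sym (trans (cong (take t) (drop-map i (shiftedBlocks σ αs))) (take-map t _)) ⟩
      take t (drop i (map length (shiftedBlocks σ αs)))
    ≡⟨ cong (λ z → take t (drop i z)) (lengths-zipWith (λ s x → offset σ αs s + x) σ αs E) ⟩
      take t (drop i (map length αs))
    ≡⟨ trans (cong (take t) (drop-map i αs)) (take-map t _) ⟩
      map length run ∎
    where open ≡-Reasoning

  module Pattern = Inflation τ run (trans length-τ (sym length-run))

  τ-at : ∀ k → k < t → τ ! k ≡ cnt (slice σ i t) (σ ! (i + k))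
  τ-at k lt = trans (!-std (slice σ i t) k (subst (k <_) (sym (length-slice σ i t it)) lt)) (cong (cnt (slice σ i t)) (!-slice σ i t k lt))

  σ∈run : ∀ k → k < t → σ ! (i + k) ∈ slice σ i t
  σ∈run k lt = ∈-slice⁺ σ i t k it lt

  count-block : ∀ k k' r → k < t → k' < t → ¬ k' ≡ k → r < length (blk αs (i + k)) →
    cnt (blk shiftedRun k') (offset σ αs (σ ! (i + k)) + blk αs (i + k) ! r)
      ≡ (if τ ! k' <ᵇ τ ! k then length (blk run k') else 0)
  count-block k k' r lt l' ne lr with <-cmp (σ ! (i + k')) (σ ! (i + k))
  ... | tri≈ _ e _ = ⊥-elim (ne (+-cancelˡ-≡ i k' k (perm-inj (i + k') (i + k) σ-perm (i+k<m k' l') (i+k<m k lt) e)))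
  ... | tri< u<w _ _ =
    trans (cong (λ z → cnt z _) (blk-shiftedRun k' l'))
      (trans (cnt-all _ _ (shift-below (α-perm (i + k') (i+k<m k' l')) (≤-trans (offset-< (i + k') (σ ! (i + k)) (i+k<m k' l') u<w) (m≤m+n _ _))))
        (trans (length-map _ (blk αs (i + k')))
          (sym (trans (if-<ᵇ-yes (τ ! k') (τ ! k) _ 0 (subst₂ _<_ (sym (τ-at k' l')) (sym (τ-at k lt)) (cnt-strict _ u<w (σ∈run k' l'))))
                      (cong length (blk-run k' l'))))))
  ... | tri> _ _ w<u =
    trans (cong (λ z → cnt z _) (blk-shiftedRun k' l'))
      (trans (cnt-none _ _ (shift-above {B = blk αs (i + k')} (≤-trans (+-monoʳ-≤ (offset σ αs (σ ! (i + k))) (<⇒≤ (perm-< r (α-perm (i + k) (i+k<m k lt)) lr)))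
                 (offset-< (i + k) (σ ! (i + k')) (i+k<m k lt) w<u))))
        (sym (if-<ᵇ-no (τ ! k') (τ ! k) _ 0
          (λ h → <⇒≱ h (subst₂ _≤_ (sym (τ-at k lt)) (sym (τ-at k' l')) (<⇒≤ (cnt-strict _ w<u (σ∈run k lt))))))))

  rank-in-run : ∀ k r → k < t → r < length (blk αs (i + k)) →
    cnt (concat shiftedRun) (offset σ αs (σ ! (i + k)) + blk αs (i + k) ! r) ≡ offset τ run (τ ! k) + blk αs (i + k) ! r
  rank-in-run k r lt lr = begin
      cnt (concat shiftedRun) v
    ≡⟨ trans (cnt-concat shiftedRun v) (cong (λ z → Σ< z (λ k' → cnt (blk shiftedRun k') v)) length-shiftedRun) ⟩
      Σ< t (λ k' → cnt (blk shiftedRun k') v)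
    ≡⟨ Σ-diff-≡ t k b lt (λ k' l' ne → count-block k k' r lt l' ne lr) own ⟩
      Σ< t g + b
    ≡⟨ cong (_+ b) (trans (cong (λ z → Σ< z g) (sym length-τ)) (sym (Pattern.offset-Σ (τ ! k)))) ⟩
      offset τ run (τ ! k) + b ∎
    where
    open ≡-Reasoning
    b = blk αs (i + k) ! r
    v = offset σ αs (σ ! (i + k)) + b
    g : ℕ → ℕ
    g k' = if τ ! k' <ᵇ τ ! k then length (blk run k') else 0
    own : cnt (blk shiftedRun k) v ≡ g k + b
    own = trans (cong (λ z → cnt z v) (blk-shiftedRun k lt))
      (trans (cnt-shift _ (blk αs (i + k)) b)
        (trans (perm-cnt (α-perm (i + k) (i+k<m k lt)) (index⇒∈ (blk αs (i + k)) r lr))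
          (cong (_+ b) (sym (if-<ᵇ-no (τ ! k) (τ ! k) _ 0 (<-irrefl refl))))))

  length-concat-shiftedRun : length (concat shiftedRun) ≡ start run t
  length-concat-shiftedRun = trans (length-concat shiftedRun)
    (trans (cong (start shiftedRun) length-shiftedRun) (start-lengths shiftedRun run lengths-shiftedRun t))

  run-pattern : std (concat shiftedRun) ≡ inflate τ run
  run-pattern = !-ext (std (concat shiftedRun)) (inflate τ run) same-length entry
    where
    same-length : length (std (concat shiftedRun)) ≡ length (inflate τ run)
    same-length = trans (length-std (concat shiftedRun)) (trans length-concat-shiftedRun (sym (trans Pattern.length-inflate (cong (start run) length-run))))
    entry : ∀ p → p < length (std (concat shiftedRun)) → std (concat shiftedRun) ! p ≡ inflate τ run ! p
    entry p lp with locate run p (subst (p <_) (trans (trans (length-std (concat shiftedRun)) length-concat-shiftedRun) (cong (start run) (sym length-run))) lp)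
    ... | k , r , lk , lr , refl =
      trans (!-std (concat shiftedRun) (start run k + r) (subst (start run k + r <_) (length-std (concat shiftedRun)) lp))
        (trans (cong (cnt (concat shiftedRun)) at)
          (trans (rank-in-run k r kt lr′)
            (sym (trans (Pattern.!-inflate k r (subst (k <_) (sym length-τ) kt) lr) (cong (λ z → offset τ run (τ ! k) + z ! r) (blk-run k kt))))))
      where
      kt : k < t
      kt = subst (k <_) length-run lk
      lr′ : r < length (blk αs (i + k))
      lr′ = subst (λ z → r < length z) (blk-run k kt) lr
      at : concat shiftedRun ! (start run k + r) ≡ offset σ αs (σ ! (i + k)) + blk αs (i + k) ! r
      at = trans (cong (λ z → concat shiftedRun ! (z + r)) (sym (start-lengths shiftedRun run lengths-shiftedRun k)))
        (trans (!-concat shiftedRun k r (subst (k <_) (sym length-shiftedRun) kt)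
                  (subst (λ z → r < length z) (sym (blk-shiftedRun k kt)) (subst (r <_) (sym (length-map _ (blk αs (i + k)))) lr′)))
          (trans (cong (_! r) (blk-shiftedRun k kt)) (!-map _ (blk αs (i + k)) r lr′)))

split-range : ∀ A n l B C l' p → A + l ≡ B → B ≤ C → C + l' ≡ A + n →
  (InRange A n p → InRange A l p ⊎ InRange B (C ∸ B) p ⊎ InRange C l' p) ×
  (InRange A l p ⊎ InRange B (C ∸ B) p ⊎ InRange C l' p → InRange A n p)
split-range A n l B C l' p e1 bc e2 = split , join
  where
  A≤B : A ≤ B
  A≤B = subst (A ≤_) e1 (m≤m+n A l)
  C≤A+n : C ≤ A + n
  C≤A+n = subst (C ≤_) e2 (m≤m+n C l')
  split : InRange A n p → InRange A l p ⊎ InRange B (C ∸ B) p ⊎ InRange C l' p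
  split (h1 , h2) with p <? B
  ... | yes pb = inj₁ (h1 , subst (p <_) (sym e1) pb)
  ... | no pb with p <? C
  ...   | yes pc = inj₂ (inj₁ (≮⇒≥ pb , subst (p <_) (sym (m+[n∸m]≡n bc)) pc))
  ...   | no pc = inj₂ (inj₂ (≮⇒≥ pc , subst (p <_) (sym e2) h2))
  join : InRange A l p ⊎ InRange B (C ∸ B) p ⊎ InRange C l' p → InRange A n p
  join (inj₁ (h1 , h2)) = h1 , <-≤-trans (subst (p <_) e1 h2) (≤-trans bc C≤A+n)
  join (inj₂ (inj₁ (h1 , h2))) = ≤-trans A≤B h1 , <-≤-trans (subst (p <_) (m+[n∸m]≡n bc) h2) C≤A+n
  join (inj₂ (inj₂ (h1 , h2))) = ≤-trans (≤-trans A≤B bc) h1 , subst (p <_) e2 h2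

InRange-empty : ∀ {A p} → ¬ InRange A 0 p
InRange-empty {A} (h1 , h2) = <⇒≱ h2 (≤-trans (≤-reflexive (+-identityʳ A)) h1)

InRange-restart : ∀ {A A' l p} → (0 < l → A ≡ A') → InRange A l p → InRange A' l p
InRange-restart {l = zero} h r = ⊥-elim (InRange-empty r)
InRange-restart {l = suc l} {p} h r = subst (λ w → InRange w (suc l) p) (h (s≤s z≤n)) r

-- The two cases of the conclusion, written once for both directions:
-- DirCase ascending is SumCase and DirCase descending is SkewCase.

SuffixAt : Direction → List ℕ → ℕ → ℕ → Set
SuffixAt d α c l = (c + l ≡ length α) × (α ≡ std (take c α) ⊙⟨ d ⟩ std (drop c α))

PrefixAt : Direction → List ℕ → ℕ → ℕ → Set
PrefixAt d α c l = (c ≡ 0) × (α ≡ std (take l α) ⊙⟨ d ⟩ std (drop l α))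

DirCase : Direction → List ℕ → List (List ℕ) → ℕ → ℕ → ℕ → ℕ → ℕ → ℕ → ℕ → ℕ → Set
DirCase d σ αs a n i t c l c' l' =
  let π  = inflate σ αs
      τ  = std (slice σ i t)
      γL = slice (blk αs (i ∸ 1)) c l
      γR = slice (blk αs (i + t)) c' l'
  in (std (slice π a n) ≡ std γL ⊙⟨ d ⟩ inflate τ (take t (drop i αs)) ⊙⟨ d ⟩ std γR)
   × (0 < l → IsInterval σ (i ∸ 1) (suc t)
              × (std (slice σ (i ∸ 1) (suc t)) ≡ (0 ∷ []) ⊙⟨ d ⟩ τ)
              × SuffixAt d (blk αs (i ∸ 1)) c l)
   × (0 < l' → IsInterval σ i (suc t)
              × (std (slice σ i (suc t)) ≡ τ ⊙⟨ d ⟩ (0 ∷ []))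
              × PrefixAt d (blk αs (i + t)) c' l')

DirCase⇒Case : ∀ d {σ αs a n i t c l c' l'} → DirCase d σ αs a n i t c l c' l' →
  SumCase σ αs a n i t c l c' l' ⊎ SkewCase σ αs a n i t c l c' l'
DirCase⇒Case ascending h = inj₁ h
DirCase⇒Case descending h = inj₂ h

Conclusion : List ℕ → List (List ℕ) → ℕ → ℕ → Set
Conclusion σ αs a n =
  Σ ℕ λ i → Σ ℕ λ t → Σ ℕ λ c → Σ ℕ λ l → Σ ℕ λ c' → Σ ℕ λ l' →
    (i + t ≤ length σ) × IsInterval σ i t
    × IsInterval (blk αs (i ∸ 1)) c l × (0 < l → 1 ≤ i)
    × IsInterval (blk αs (i + t)) c' l' × (0 < l' → i + t < length σ)
    × (∀ p → (InRange a n p →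
                InRange (start αs (i ∸ 1) + c) l p
                ⊎ InRange (start αs i) (start αs (i + t) ∸ start αs i) p
                ⊎ InRange (start αs (i + t) + c') l' p)
           × (InRange (start αs (i ∸ 1) + c) l p
                ⊎ InRange (start αs i) (start αs (i + t) ∸ start αs i) p
                ⊎ InRange (start αs (i + t) + c') l' p → InRange a n p))
    × (SumCase σ αs a n i t c l c' l' ⊎ SkewCase σ αs a n i t c l c' l')

-- an empty θ is described by taking every part empty (the hypotheses then
-- force σ to be empty, but the description holds regardless)
empty-conclusion : ∀ σ αs a → Conclusion σ αs a 0
empty-conclusion σ αs a =
  0 , 0 , 0 , 0 , 0 , 0 , z≤n , (z≤n , λ ()) , (z≤n , λ ()) , (λ ()) , (z≤n , λ ()) , (λ ()) ,
  (λ p → (λ r → ⊥-elim (InRange-empty r)) ,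
         λ { (inj₁ r) → ⊥-elim (InRange-empty r) ; (inj₂ (inj₁ (_ , ()))) ; (inj₂ (inj₂ (_ , ()))) }) ,
  inj₁ (refl , (λ ()) , (λ ()))

module Main (σ : List ℕ) (αs : List (List ℕ)) (σ-perm : IsPerm σ) (length-αs : length αs ≡ length σ)
            (αs-perms : All (λ α → IsPerm α × (1 ≤ length α)) αs)
            (a n' : ℕ) (θ-interval : IsInterval (inflate σ αs) a (suc n'))
            (not-in-one-block : ¬ (Σ ℕ λ k → (k < length σ)
                     × (∀ p → InRange a (suc n') p → InRange (start αs k) (length (blk αs k)) p))) where

  E : length σ ≡ length αs
  E = sym length-αs
  open Inflation σ αs E

  m : ℕ
  m = length σ
  n : ℕ
  n = suc n'
  π : List ℕ
  π = inflate σ αs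
  P : ℕ → ℕ
  P k = start αs k
  s : ℕ → ℕ
  s k = length (blk αs k)
  O : ℕ → ℕ
  O k = offset σ αs (σ ! k)
  N : ℕ
  N = P m
  opaque
    val : ℕ → ℕ
    val p = π ! p

  α-perm : ∀ k → k < m → IsPerm (blk αs k)
  α-perm k lt = proj₁ (All-lookup-blk αs k αs-perms (subst (k <_) E lt))

  s≥1 : ∀ k → k < m → 1 ≤ s k
  s≥1 k lt = proj₂ (All-lookup-blk αs k αs-perms (subst (k <_) E lt))

  last<s : ∀ k → k < m → s k ∸ 1 < s k
  last<s k lk = subst (s k ∸ 1 <_) (m+[n∸m]≡n (s≥1 k lk)) ≤-refl

  length-π : length π ≡ N
  length-π = trans length-inflate (cong (start αs) length-αs)

  opaque
    unfolding val
    val-block : ∀ k r → k < m → r < s k → val (P k + r) ≡ O k + blk αs k ! r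
    val-block k r lk lr = !-inflate k r lk lr

  val-lower : ∀ k r → k < m → r < s k → O k ≤ val (P k + r)
  val-lower k r lk lr = subst (O k ≤_) (sym (val-block k r lk lr)) (m≤m+n (O k) _)

  val-upper : ∀ k r → k < m → r < s k → val (P k + r) < O k + s k
  val-upper k r lk lr = subst (_< O k + s k) (sym (val-block k r lk lr)) (+-monoʳ-< (O k) (perm-< r (α-perm k lk) lr))

  σ-inj : ∀ k k' → k < m → k' < m → σ ! k ≡ σ ! k' → k ≡ k'
  σ-inj k k' lk lk' e = perm-inj k k' σ-perm lk lk' e

  block-< : ∀ k k' r r' → k < m → k' < m → r < s k → r' < s k' → σ ! k < σ ! k' → val (P k + r) < val (P k' + r')
  block-< k k' r r' lk lk' lr lr' lt = <-≤-trans (val-upper k r lk lr) (≤-trans (offset-< k (σ ! k') lk lt) (val-lower k' r' lk' lr'))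

  block-cmp : ∀ k k' r r' → k < m → k' < m → r < s k → r' < s k' → ¬ k ≡ k' → val (P k + r) < val (P k' + r') → σ ! k < σ ! k'
  block-cmp k k' r r' lk lk' lr lr' ne lt with <-cmp (σ ! k) (σ ! k')
  ... | tri< h _ _ = h
  ... | tri≈ _ e _ = ⊥-elim (ne (σ-inj k k' lk lk' e))
  ... | tri> _ _ h = ⊥-elim (<-asym lt (block-< k' k r' r lk' lk lr' lr h))

  block-≺ : ∀ d k k' r r' → k < m → k' < m → r < s k → r' < s k' → σ ! k ≺⟨ d ⟩ σ ! k' → val (P k + r) ≺⟨ d ⟩ val (P k' + r')
  block-≺ ascending k k' r r' lk lk' lr lr' = block-< k k' r r' lk lk' lr lr'
  block-≺ descending k k' r r' lk lk' lr lr' = block-< k' k r' r lk' lk lr' lr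

  block-cmp≺ : ∀ d k k' r r' → k < m → k' < m → r < s k → r' < s k' → ¬ k ≡ k' →
    val (P k + r) ≺⟨ d ⟩ val (P k' + r') → σ ! k ≺⟨ d ⟩ σ ! k'
  block-cmp≺ ascending k k' r r' lk lk' lr lr' ne = block-cmp k k' r r' lk lk' lr lr' ne
  block-cmp≺ descending k k' r r' lk lk' lr lr' ne = block-cmp k' k r' r lk' lk lr' lr (λ e → ne (sym e))

  within-block : ∀ d k u v → k < m → u < s k → v < s k → val (P k + u) ≺⟨ d ⟩ val (P k + v) →
                 blk αs k ! u ≺⟨ d ⟩ blk αs k ! v
  within-block d k u v lk lu lv h =
    ≺-cancel d (O k) (subst₂ (λ x y → x ≺⟨ d ⟩ y) (val-block k u lk lu) (val-block k v lk lv) h)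

  position-< : ∀ k k' r r' → k < k' → r < s k → P k + r < P k' + r'
  position-< k k' r r' lt lr = <-≤-trans (+-monoʳ-< (P k) lr)
    (≤-trans (≤-reflexive (sym (start-suc αs k))) (≤-trans (start-mono αs lt) (m≤m+n (P k') r')))

  position-≤ : ∀ k k' r r' → r' < s k' → P k + r ≤ P k' + r' → k ≤ k'
  position-≤ k k' r r' lr' le with k ≤? k'
  ... | yes h = h
  ... | no h = ⊥-elim (<⇒≱ (position-< k' k r' r (≰⇒> h) lr') le)

  position-<N : ∀ k r → k < m → r < s k → P k + r < N
  position-<N k r lk lr = <-≤-trans (+-monoʳ-< (P k) lr) (≤-trans (≤-reflexive (sym (start-suc αs k))) (start-mono αs lk))

  record Location (p : ℕ) : Set where
    constructor mkLocation
    field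
      block : ℕ
      entry : ℕ
      block<m : block < m
      entry<s : entry < s block
      position : p ≡ P block + entry

  locate-π : ∀ p → p < N → Location p
  locate-π p lt with locate αs p (subst (p <_) (cong (start αs) E) lt)
  ... | k , r , lk , lr , e = mkLocation k r (subst (k <_) length-αs lk) lr e

  val-inj : ∀ p q → p < N → q < N → val p ≡ val q → p ≡ q
  val-inj p q lp lq e with locate-π p lp | locate-π q lq
  ... | mkLocation k r lk lr refl | mkLocation k' r' lk' lr' refl with <-cmp (σ ! k) (σ ! k')
  ...   | tri< h _ _ = ⊥-elim (<-irrefl e (block-< k k' r r' lk lk' lr lr' h))
  ...   | tri> _ _ h = ⊥-elim (<-irrefl (sym e) (block-< k' k r' r lk' lk lr' lr h))
  ...   | tri≈ _ h _ with σ-inj k k' lk lk' h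
  ...     | refl = cong (P k +_) (perm-inj r r' (α-perm k lk) lr lr'
                       (+-cancelˡ-≡ (O k) _ _ (trans (sym (val-block k r lk lr)) (trans e (val-block k r' lk lr')))))

  Inθ : ℕ → Set
  Inθ p = InRange a n p

  a+n≤N : a + n ≤ N
  a+n≤N = subst (a + n ≤_) length-π (proj₁ θ-interval)

  Inθ⇒<N : ∀ {p} → Inθ p → p < N
  Inθ⇒<N (_ , h) = <-≤-trans h a+n≤N

  opaque
    unfolding val
    θ-convex : ∀ {q1 q2 v} → Inθ q1 → Inθ q2 → val q1 ≤ v → v ≤ val q2 → Σ ℕ λ q → Inθ q × (val q ≡ v)
    θ-convex {q1} {q2} t1 t2 l1 l2 with ∈-slice⁻ π a n (proj₁ θ-interval) (proj₂ θ-interval (∈θ t1) (∈θ t2) l1 l2)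
      where
      ∈θ : ∀ {q} → Inθ q → val q ∈ slice π a n
      ∈θ {q} (h1 , h2) = ∈-slice⁺′ π a n q (proj₁ θ-interval) h1 h2
    ... | p , pl , _ , e = a + p , (m≤m+n a p , +-monoʳ-< a pl) , e

  outside-θ : ∀ {p q1 q2} → p < N → ¬ Inθ p → Inθ q1 → Inθ q2 → val q1 ≤ val p → val p ≤ val q2 → ⊥
  outside-θ {p} lp np t1 t2 l1 l2 with θ-convex t1 t2 l1 l2
  ... | q , tq , e = np (subst Inθ (val-inj q p (Inθ⇒<N tq) lp e) tq)

  outside-before : ∀ d {p q q'} → p < N → ¬ Inθ p → Inθ q → Inθ q' → val p ≺⟨ d ⟩ val q → val p ≺⟨ d ⟩ val q'
  outside-before ascending {p} {q} {q'} lp np tq tq' lt with val p <? val q'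
  ... | yes h = h
  ... | no h = ⊥-elim (outside-θ lp np tq' tq (≮⇒≥ h) (<⇒≤ lt))
  outside-before descending {p} {q} {q'} lp np tq tq' lt with val q' <? val p
  ... | yes h = h
  ... | no h = ⊥-elim (outside-θ lp np tq tq' (<⇒≤ lt) (≮⇒≥ h))

  outside-after : ∀ d {p q q'} → p < N → ¬ Inθ p → Inθ q → Inθ q' → val q ≺⟨ d ⟩ val p → val q' ≺⟨ d ⟩ val p
  outside-after ascending = outside-before descending
  outside-after descending = outside-before ascending

  block-in-θ : ∀ {q1 q2} k → k < m → Inθ q1 → Inθ q2 → val q1 ≤ O k → O k + s k ≤ suc (val q2) →
               ∀ r → r < s k → Inθ (P k + r)
  block-in-θ {q1} {q2} k lk t1 t2 l1 l2 r lr
    with θ-convex t1 t2 (≤-trans l1 (val-lower k r lk lr)) (≤-pred (≤-trans (val-upper k r lk lr) l2))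
  ... | q , tq , e = subst Inθ (val-inj q (P k + r) (Inθ⇒<N tq) (position-<N k r lk lr) e) tq

  z : ℕ
  z = a + n'
  a∈θ : Inθ a
  a∈θ = ≤-refl , m<m+n a (s≤s z≤n)
  z∈θ : Inθ z
  z∈θ = m≤m+n a n' , ≤-reflexive (sym (+-suc a n'))

  opaque
    first : Location a
    first = locate-π a (Inθ⇒<N a∈θ)
    last : Location z
    last = locate-π z (Inθ⇒<N z∈θ)
  open Location first renaming (block to k0; entry to r0; block<m to k0<m; entry<s to r0<s; position to a≡)
  open Location last renaming (block to k1; entry to r1; block<m to k1<m; entry<s to r1<s; position to z≡)

  θ-in-block : k0 ≡ k1 → ∀ p → Inθ p → InRange (P k0) (s k0) p
  θ-in-block e p (h1 , h2) =
    ≤-trans (≤-trans (m≤m+n (P k0) r0) (≤-reflexive (sym a≡))) h1 ,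
    ≤-trans (s≤s (≤-pred (≤-trans h2 (≤-reflexive (+-suc a n'))))) z<end
    where
    z<end : suc z ≤ P k0 + s k0
    z<end = subst (λ w → suc z ≤ P w + s w) (sym e) (subst (λ w → suc w ≤ P k1 + s k1) (sym z≡) (+-monoʳ-< (P k1) r1<s))

  k0<k1 : k0 < k1
  k0<k1 with <-cmp k0 k1
  ... | tri< h _ _ = h
  ... | tri≈ _ e _ = ⊥-elim (not-in-one-block (k0 , k0<m , θ-in-block e))
  ... | tri> _ _ h = ⊥-elim (<⇒≱ (subst₂ _<_ (sym z≡) (sym a≡) (position-< k1 k0 r1 r0 h r1<s)) (m≤m+n a n'))

  direction : Σ Direction λ d → σ ! k0 ≺⟨ d ⟩ σ ! k1
  direction with <-cmp (σ ! k0) (σ ! k1)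
  ... | tri< h _ _ = ascending , h
  ... | tri> _ _ h = descending , h
  ... | tri≈ _ h _ = ⊥-elim (<⇒≢ k0<k1 (σ-inj k0 k1 k0<m k1<m h))

  -- The shape of θ: either θ starts at the start of block i (and γ_L is
  -- empty), or θ starts inside block k₀ = i - 1 at offset c = r₀ > 0 and
  -- γ_L is the remaining l entries of that block.  Dually θ ends at the end
  -- of block i+t-1, or inside block k₁ = i + t after l' entries.
  LeftEnd : ℕ → ℕ → ℕ → Set
  LeftEnd i c l = (l ≡ 0 × c ≡ 0 × P i ≡ a) ⊎ ((i ≡ suc k0) × (c ≡ r0) × (0 < c) × (c + l ≡ s k0) × (0 < l))

  RightEnd : ℕ → ℕ → Set
  RightEnd e l' = (l' ≡ 0 × P e ≡ a + n) ⊎ ((e ≡ k1) × (0 < l') × (l' < s k1) × (P e + l' ≡ a + n))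

  record Shape : Set where
    constructor mkShape
    field
      i t c l l' : ℕ
      i+t≤m : i + t ≤ m
      left-end : LeftEnd i c l
      right-end : RightEnd (i + t) l'

  left-end-exists : Σ ℕ λ i → Σ ℕ λ c → Σ ℕ λ l → (i ≤ k1) × LeftEnd i c l
  left-end-exists with r0 ≟ 0
  ... | yes r0≡0 = k0 , 0 , 0 , <⇒≤ k0<k1 , inj₁ (refl , refl , trans (sym (+-identityʳ (P k0))) (trans (cong (P k0 +_) (sym r0≡0)) (sym a≡)))
  ... | no r0≢0 = suc k0 , r0 , s k0 ∸ r0 , k0<k1 , inj₂ (refl , refl , n≢0⇒n>0 r0≢0 , m+[n∸m]≡n (<⇒≤ r0<s) , m<n⇒0<n∸m r0<s)

  θ-end : P k1 + suc r1 ≡ a + n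
  θ-end = trans (+-suc (P k1) r1) (trans (cong suc (sym z≡)) (sym (+-suc a n')))

  right-end-exists : Σ ℕ λ e → Σ ℕ λ l' → (k1 ≤ e) × (e ≤ m) × RightEnd e l'
  right-end-exists with suc r1 ≟ s k1
  ... | yes e = suc k1 , 0 , n≤1+n k1 , k1<m , inj₁ (refl , trans (start-suc αs k1) (trans (cong (P k1 +_) (sym e)) θ-end))
  ... | no ne = k1 , suc r1 , ≤-refl , <⇒≤ k1<m , inj₂ (refl , s≤s z≤n , ≤∧≢⇒< r1<s ne , θ-end)

  shape : Shape
  shape with left-end-exists | right-end-exists
  ... | i , c , l , i≤k1 , L | e , l' , k1≤e , e≤m , R =
    mkShape i (e ∸ i) c l l' (≤-trans (≤-reflexive i+t≡e) e≤m) L (subst (λ w → RightEnd w l') (sym i+t≡e) R)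
    where
    i+t≡e : i + (e ∸ i) ≡ e
    i+t≡e = m+[n∸m]≡n (≤-trans i≤k1 k1≤e)

  Meetsθ : ℕ → Set
  Meetsθ k = Σ ℕ λ r → (r < s k) × Inθ (P k + r)

  k0-meets : Meetsθ k0
  k0-meets = r0 , r0<s , subst Inθ a≡ a∈θ
  k1-meets : Meetsθ k1
  k1-meets = r1 , r1<s , subst Inθ z≡ z∈θ

  module WithShape (S : Shape) where
    open Shape S

    a+l≡Pi : a + l ≡ P i
    a+l≡Pi with left-end
    ... | inj₁ (l0 , _ , Pi) = trans (cong (a +_) l0) (trans (+-identityʳ a) (sym Pi))
    ... | inj₂ (refl , refl , _ , cl , _) =
      trans (cong (_+ l) a≡) (trans (+-assoc (P k0) r0 l) (trans (cong (P k0 +_) cl) (sym (start-suc αs k0))))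

    Pi≤Pit : P i ≤ P (i + t)
    Pi≤Pit = start-mono αs (m≤m+n i t)

    Pit+l'≡a+n : P (i + t) + l' ≡ a + n
    Pit+l'≡a+n with right-end
    ... | inj₁ (refl , e) = trans (+-identityʳ _) e
    ... | inj₂ (_ , _ , _ , e) = e

    Pit≤a+n : P (i + t) ≤ a + n
    Pit≤a+n = subst (P (i + t) ≤_) Pit+l'≡a+n (m≤m+n _ l')

    left-part : 0 < l → (i ≡ suc k0) × (c ≡ r0) × (0 < c) × (c + l ≡ s k0)
    left-part lp with left-end
    ... | inj₁ (refl , _) = ⊥-elim (<-irrefl refl lp)
    ... | inj₂ (e1 , e2 , e3 , e4 , _) = e1 , e2 , e3 , e4

    right-part : 0 < l' → (i + t ≡ k1) × (l' < s (i + t))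
    right-part lp with right-end
    ... | inj₁ (refl , _) = ⊥-elim (<-irrefl refl lp)
    ... | inj₂ (e1 , _ , l'< , _) = e1 , subst (λ v → l' < s v) (sym e1) l'<

    i+t<m : 0 < l' → i + t < m
    i+t<m lp = subst (_< m) (sym (proj₁ (right-part lp))) k1<m

    middle-in-θ : ∀ k r → i ≤ k → k < i + t → r < s k → Inθ (P k + r)
    middle-in-θ k r ik kt lr = ≤-trans (≤-trans (m≤m+n a l) (≤-trans (≤-reflexive a+l≡Pi) (start-mono αs ik))) (m≤m+n (P k) r) ,
      <-≤-trans (+-monoʳ-< (P k) lr) (≤-trans (≤-reflexive (sym (start-suc αs k))) (≤-trans (start-mono αs kt) Pit≤a+n))

    middle-meets : ∀ k → i ≤ k → k < i + t → Meetsθ k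
    middle-meets k ik kt = 0 , s≥1 k (<-≤-trans kt i+t≤m) , middle-in-θ k 0 ik kt (s≥1 k (<-≤-trans kt i+t≤m))

    γL-in-θ : 0 < l → ∀ p → p < l → Inθ (P (i ∸ 1) + (c + p))
    γL-in-θ lp p pl with left-part lp
    ... | refl , refl , _ , _ = ≤-trans (≤-reflexive a≡) (+-monoʳ-≤ (P k0) (m≤m+n r0 p)) ,
      <-≤-trans (+-monoʳ-< (P k0) (+-monoʳ-< r0 pl))
        (≤-trans (≤-reflexive (trans (sym (+-assoc (P k0) r0 l)) (trans (cong (_+ l) (sym a≡)) a+l≡Pi))) (≤-trans Pi≤Pit Pit≤a+n))

    γR-in-θ : ∀ p → p < l' → Inθ (P (i + t) + p)
    γR-in-θ p pl = ≤-trans (≤-trans (m≤m+n a l) (≤-trans (≤-reflexive a+l≡Pi) Pi≤Pit)) (m≤m+n _ p) ,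
                   <-≤-trans (+-monoʳ-< (P (i + t)) pl) (≤-reflexive Pit+l'≡a+n)

    right-meets : 0 < l' → Meetsθ (i + t)
    right-meets lp = 0 , ≤-trans (s≤s z≤n) (proj₂ (right-part lp)) , γR-in-θ 0 lp

    before-γL-outside : ∀ ro → ro < r0 → ¬ Inθ (P k0 + ro)
    before-γL-outside ro lt th = <⇒≱ (+-monoʳ-< (P k0) lt) (≤-trans (≤-reflexive (sym a≡)) (proj₁ th))

    after-γR-outside : ∀ ro → l' ≤ ro → ¬ Inθ (P (i + t) + ro)
    after-γR-outside ro le th = <⇒≱ (<-≤-trans (proj₂ th) (≤-reflexive (sym Pit+l'≡a+n))) (+-monoʳ-≤ (P (i + t)) le)

    full-block-starts-after : ∀ k → k < m → (∀ r → r < s k → Inθ (P k + r)) → i ≤ k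
    full-block-starts-after k lk h with left-end
    ... | inj₁ (_ , _ , Pi) = position-≤ i k 0 0 (s≥1 k lk) (subst₂ _≤_ (sym (trans (+-identityʳ (P i)) Pi)) refl (proj₁ (h 0 (s≥1 k lk))))
    ... | inj₂ (refl , refl , c>0 , _ , _) with m≤n⇒m<n∨m≡n (position-≤ k0 k r0 0 (s≥1 k lk) (≤-trans (≤-reflexive (sym a≡)) (proj₁ (h 0 (s≥1 k lk)))))
    ...   | inj₁ lt = lt
    ...   | inj₂ refl = ⊥-elim (<⇒≱ c>0 (+-cancelˡ-≤ (P k0) r0 0 (≤-trans (≤-reflexive (sym a≡)) (proj₁ (h 0 (s≥1 k lk))))))

    full-block-ends-before : ∀ k → k < m → (∀ r → r < s k → Inθ (P k + r)) → k < i + t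
    full-block-ends-before k lk h with i + t ≤? k
    ... | no h' = ≰⇒> h'
    ... | yes ek with right-end | m≤n⇒m<n∨m≡n ek
    ...   | inj₁ (_ , e) | _ =
      ⊥-elim (<⇒≱ (proj₂ (h (s k ∸ 1) (last<s k lk))) (≤-trans (≤-reflexive (sym e)) (≤-trans (start-mono αs ek) (m≤m+n (P k) _))))
    ...   | inj₂ (e1 , _ , l'< , e) | inj₁ lt =
      ⊥-elim (<⇒≱ (proj₂ (h 0 (s≥1 k lk))) (≤-trans (≤-reflexive (sym e)) (<⇒≤ (position-< (i + t) k l' 0 lt (subst (λ v → l' < s v) (sym e1) l'<)))))
    ...   | inj₂ (e1 , _ , l'< , e) | inj₂ refl =
      ⊥-elim (<⇒≱ (+-cancelˡ-< (P k) _ l' (subst (P k + (s k ∸ 1) <_) (sym e) (proj₂ (h (s k ∸ 1) (last<s k lk)))))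
                  (≤-pred (subst (l' <_) (sym (m+[n∸m]≡n (s≥1 k lk))) (subst (λ v → l' < s v) (sym e1) l'<))))

    σ-between : ∀ kx kz → kx < m → kz < m → Meetsθ kx → Meetsθ kz → ∀ y → σ ! kx < y → y < σ ! kz →
                Σ ℕ λ k → (σ ! k ≡ y) × (i ≤ k) × (k < i + t)
    σ-between kx kz lx lz (rx , rxs , tx) (rz , rzs , tz) y l1 l2 with perm-surj y σ-perm (<-trans l2 (perm-< kz σ-perm lz))
    ... | k , lk , ek = k , ek , full-block-starts-after k lk inθ , full-block-ends-before k lk inθ
      where
      lo : val (P kx + rx) ≤ O k
      lo = <⇒≤ (<-≤-trans (val-upper kx rx lx rxs) (subst (λ v → O kx + s kx ≤ offset σ αs v) (sym ek) (offset-< kx y lx l1)))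
      hi : O k + s k ≤ suc (val (P kz + rz))
      hi = m≤n⇒m≤1+n (≤-trans (offset-< k (σ ! kz) lk (subst (_< σ ! kz) (sym ek) l2)) (val-lower kz rz lz rzs))
      inθ : ∀ r → r < s k → Inθ (P k + r)
      inθ = block-in-θ k lk tx tz lo hi

    window-contig : ∀ j u → j + u ≤ m → (∀ k → j ≤ k → k < j + u → Meetsθ k) →
                    (∀ k → i ≤ k → k < i + t → (j ≤ k) × (k < j + u)) → Contig (slice σ j u)
    window-contig j u ju meets covers {x} {y} {w} mx mw xy yw with m≤n⇒m<n∨m≡n xy | m≤n⇒m<n∨m≡n yw
    ... | inj₂ refl | _ = mx
    ... | inj₁ _ | inj₂ refl = mw
    ... | inj₁ x<y | inj₁ y<w with ∈-slice⁻ σ j u ju mx | ∈-slice⁻ σ j u ju mw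
    ...   | px , pxu , pxm , refl | pw , pwu , pwm , refl
      with σ-between (j + px) (j + pw) pxm pwm (meets (j + px) (m≤m+n j px) (+-monoʳ-< j pxu))
                     (meets (j + pw) (m≤m+n j pw) (+-monoʳ-< j pwu)) y x<y y<w
    ...     | k , refl , ik , kt = ∈-slice⁺′ σ j u k ju (proj₁ (covers k ik kt)) (proj₂ (covers k ik kt))

    part-contig : ∀ k → k < m → ∀ c l → c + l ≤ s k → (∀ p → p < l → Inθ (P k + (c + p))) →
                  (∀ r → r < s k → Inθ (P k + r) → (c ≤ r) × (r < c + l)) → Contig (slice (blk αs k) c l)
    part-contig k lk c l cl inside only {x} {y} {w} mx mw xy yw
      with ∈-slice⁻ (blk αs k) c l cl mx | ∈-slice⁻ (blk αs k) c l cl mw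
    ... | px , pxl , pxs , refl | pw , pwl , pws , refl
      with perm-surj y (α-perm k lk) (≤-<-trans yw (perm-< (c + pw) (α-perm k lk) pws))
    ...   | ry , rys , refl with θ-convex (inside px pxl) (inside pw pwl) (lift xy pxs rys) (lift yw rys pws)
      where
      lift : ∀ {u v} → blk αs k ! u ≤ blk αs k ! v → u < s k → v < s k → val (P k + u) ≤ val (P k + v)
      lift le lu lv = subst₂ _≤_ (sym (val-block k _ lk lu)) (sym (val-block k _ lk lv)) (+-monoʳ-≤ (O k) le)
    ...     | q , tq , eq with only ry rys (subst Inθ (val-inj q (P k + ry) (Inθ⇒<N tq) (position-<N k ry lk rys) eq) tq)
    ...       | cr , rcl = ∈-slice⁺′ (blk αs k) c l ry cl cr rcl

    middle-interval : IsInterval σ i t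
    middle-interval = i+t≤m , window-contig i t i+t≤m middle-meets (λ k ik kt → ik , kt)

    γL-interval : IsInterval (blk αs (i ∸ 1)) c l
    γL-interval with left-end
    ... | inj₁ (refl , refl , _) = z≤n , λ ()
    ... | inj₂ (refl , refl , c>0 , cl , l>0) =
      ≤-reflexive cl , part-contig k0 k0<m r0 l (≤-reflexive cl) (γL-in-θ l>0) only
      where
      only : ∀ r → r < s k0 → Inθ (P k0 + r) → (r0 ≤ r) × (r < r0 + l)
      only r rs th = +-cancelˡ-≤ (P k0) r0 r (≤-trans (≤-reflexive (sym a≡)) (proj₁ th)) , subst (r <_) (sym cl) rs

    γR-interval : IsInterval (blk αs (i + t)) 0 l'
    γR-interval with right-end
    ... | inj₁ (refl , _) = z≤n , λ ()
    ... | inj₂ (e1 , l'>0 , _ , e) =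
      <⇒≤ l'<s , part-contig (i + t) (i+t<m l'>0) 0 l' (<⇒≤ l'<s) γR-in-θ only
      where
      l'<s : l' < s (i + t)
      l'<s = proj₂ (right-part l'>0)
      only : ∀ r → r < s (i + t) → Inθ (P (i + t) + r) → (0 ≤ r) × (r < 0 + l')
      only r rs th = z≤n , +-cancelˡ-< (P (i + t)) r l' (<-≤-trans (proj₂ th) (≤-reflexive (sym e)))

    γL-nonempty⇒1≤i : 0 < l → 1 ≤ i
    γL-nonempty⇒1≤i lp with left-part lp
    ... | refl , _ = s≤s z≤n

    γL-start : 0 < l → P (i ∸ 1) + c ≡ a
    γL-start lp with left-part lp
    ... | refl , refl , _ = sym a≡

    Parts : ℕ → Set
    Parts p = InRange (start αs (i ∸ 1) + c) l p
              ⊎ InRange (start αs i) (start αs (i + t) ∸ start αs i) p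
              ⊎ InRange (start αs (i + t) + 0) l' p

    θ-cover : ∀ p → (InRange a n p → Parts p) × (Parts p → InRange a n p)
    θ-cover p = from-θ , to-θ
      where
      ranges : (InRange a n p → InRange a l p ⊎ InRange (P i) (P (i + t) ∸ P i) p ⊎ InRange (P (i + t)) l' p)
             × (InRange a l p ⊎ InRange (P i) (P (i + t) ∸ P i) p ⊎ InRange (P (i + t)) l' p → InRange a n p)
      ranges = split-range a n l (P i) (P (i + t)) l' p a+l≡Pi Pi≤Pit Pit+l'≡a+n
      +0 : InRange (P (i + t)) l' p ≡ InRange (P (i + t) + 0) l' p
      +0 = cong (λ w → InRange w l' p) (sym (+-identityʳ _))
      from-θ : InRange a n p → Parts p
      from-θ th with proj₁ ranges th
      ... | inj₁ h = inj₁ (InRange-restart (λ lp → sym (γL-start lp)) h)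
      ... | inj₂ (inj₁ h) = inj₂ (inj₁ h)
      ... | inj₂ (inj₂ h) = inj₂ (inj₂ (subst (λ T → T) +0 h))
      to-θ : Parts p → InRange a n p
      to-θ (inj₁ h) = proj₂ ranges (inj₁ (InRange-restart γL-start h))
      to-θ (inj₂ (inj₁ h)) = proj₂ ranges (inj₂ (inj₁ h))
      to-θ (inj₂ (inj₂ h)) = proj₂ ranges (inj₂ (inj₂ (subst (λ T → T) (sym +0) h)))

    module Run = BlockRun σ αs E σ-perm α-perm i t i+t≤m

    γL γR shiftedγL shiftedγR middle rest : List ℕ
    γL = slice (blk αs (i ∸ 1)) c l
    γR = slice (blk αs (i + t)) 0 l'
    shiftedγL = map (O (i ∸ 1) +_) γL
    shiftedγR = map (O (i + t) +_) γR
    middle = concat Run.shiftedRun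
    rest = concat (drop i (shiftedBlocks σ αs))

    drop-a : drop a π ≡ shiftedγL ++ rest
    drop-a with left-end
    ... | inj₁ (refl , refl , Pi) =
      trans (cong (λ w → drop w (concat (shiftedBlocks σ αs))) (trans (sym Pi) (sym (start-shiftedBlocks i))))
            (drop-concat0 (shiftedBlocks σ αs) i)
    ... | inj₂ (refl , refl , c>0 , cl , _) = begin
        drop a (concat (shiftedBlocks σ αs))
      ≡⟨ cong (λ w → drop w (concat (shiftedBlocks σ αs))) (trans a≡ (cong (_+ r0) (sym (start-shiftedBlocks k0)))) ⟩
        drop (start (shiftedBlocks σ αs) k0 + r0) (concat (shiftedBlocks σ αs))
      ≡⟨ drop-concat (shiftedBlocks σ αs) k0 r0 (subst (k0 <_) (sym length-shiftedBlocks) k0<m)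
           (subst (r0 ≤_) (sym (trans (cong length (blk-shiftedBlocks k0 k0<m)) (length-map _ (blk αs k0)))) (<⇒≤ r0<s)) ⟩
        drop r0 (blk (shiftedBlocks σ αs) k0) ++ rest
      ≡⟨ cong (_++ rest) (trans (cong (drop r0) (blk-shiftedBlocks k0 k0<m)) (drop-map r0 (blk αs k0))) ⟩
        map (O k0 +_) (drop r0 (blk αs k0)) ++ rest
      ≡⟨ cong (λ w → map (O k0 +_) w ++ rest) (sym (take-all l (drop r0 (blk αs k0)) drop-length)) ⟩
        shiftedγL ++ rest ∎
      where
      open ≡-Reasoning
      drop-length : length (drop r0 (blk αs k0)) ≤ l
      drop-length = ≤-reflexive (trans (length-drop r0 (blk αs k0)) (trans (cong (_∸ r0) (sym cl)) (m+n∸m≡n r0 l)))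

    length-shiftedγL : length shiftedγL ≡ l
    length-shiftedγL = trans (length-map _ γL) (length-slice (blk αs (i ∸ 1)) c l (proj₁ γL-interval))

    n-split : n ≡ l + (start (drop i (shiftedBlocks σ αs)) t + l')
    n-split = +-cancelˡ-≡ a n _ (begin
        a + n
      ≡⟨ sym Pit+l'≡a+n ⟩
        P (i + t) + l'
      ≡⟨ cong (_+ l') (trans (sym (start-shiftedBlocks (i + t))) (start-drop (shiftedBlocks σ αs) i t)) ⟩
        start (shiftedBlocks σ αs) i + start (drop i (shiftedBlocks σ αs)) t + l'
      ≡⟨ cong (λ w → w + start (drop i (shiftedBlocks σ αs)) t + l') (trans (start-shiftedBlocks i) (sym a+l≡Pi)) ⟩
        a + l + start (drop i (shiftedBlocks σ αs)) t + l'
      ≡⟨ trans (+-assoc (a + l) _ l') (+-assoc a l _) ⟩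
        a + (l + (start (drop i (shiftedBlocks σ αs)) t + l')) ∎)
      where open ≡-Reasoning

    γR-prefix : (l' ≤ length (blk (drop i (shiftedBlocks σ αs)) t)) × (take l' (blk (drop i (shiftedBlocks σ αs)) t) ≡ shiftedγR)
    γR-prefix with right-end
    ... | inj₁ (refl , _) = z≤n , refl
    ... | inj₂ (e1 , l'>0 , l'< , _) =
      subst (l' ≤_) (sym block-length) (<⇒≤ (proj₂ (right-part l'>0))) ,
      trans (cong (take l') block) (take-map l' (blk αs (i + t)))
      where
      block : blk (drop i (shiftedBlocks σ αs)) t ≡ map (O (i + t) +_) (blk αs (i + t))
      block = trans (blk-drop (shiftedBlocks σ αs) i t) (blk-shiftedBlocks (i + t) (i+t<m l'>0))
      block-length : length (blk (drop i (shiftedBlocks σ αs)) t) ≡ s (i + t)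
      block-length = trans (cong length block) (length-map _ (blk αs (i + t)))

    θ-entries : slice π a n ≡ (shiftedγL ++ middle) ++ shiftedγR
    θ-entries = begin
        take n (drop a π)
      ≡⟨ cong (take n) drop-a ⟩
        take n (shiftedγL ++ rest)
      ≡⟨ cong (λ w → take w (shiftedγL ++ rest)) (trans n-split (cong (_+ _) (sym length-shiftedγL))) ⟩
        take (length shiftedγL + (start (drop i (shiftedBlocks σ αs)) t + l')) (shiftedγL ++ rest)
      ≡⟨ take-++ʳ shiftedγL rest _ ⟩
        shiftedγL ++ take (start (drop i (shiftedBlocks σ αs)) t + l') rest
      ≡⟨ cong (shiftedγL ++_) (take-concat (drop i (shiftedBlocks σ αs)) t l' (proj₁ γR-prefix)) ⟩
        shiftedγL ++ (middle ++ take l' (blk (drop i (shiftedBlocks σ αs)) t))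
      ≡⟨ cong (λ w → shiftedγL ++ (middle ++ w)) (proj₂ γR-prefix) ⟩
        shiftedγL ++ (middle ++ shiftedγR)
      ≡⟨ sym (++-assoc shiftedγL middle shiftedγR) ⟩
        (shiftedγL ++ middle) ++ shiftedγR ∎
      where open ≡-Reasoning

    ∈shiftedγL : ∀ {x} → x ∈ shiftedγL → (0 < l) × (Σ ℕ λ r → (r < s k0) × Inθ (P k0 + r) × (x ≡ val (P k0 + r)))
    ∈shiftedγL {x} mx with left-end
    ... | inj₁ (refl , refl , _) with () ← mx
    ... | inj₂ (refl , refl , c>0 , cl , l>0) with ∈-map⁻ (O k0 +_) mx
    ...   | y , my , refl with ∈-slice⁻ (blk αs k0) r0 l (≤-reflexive cl) my
    ...     | p , pl , sp , e = l>0 , r0 + p , sp , γL-in-θ l>0 p pl ,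
                trans (cong (O k0 +_) (sym e)) (sym (val-block k0 (r0 + p) k0<m sp))

    ∈middle : ∀ {x} → x ∈ middle → Σ ℕ λ k → Σ ℕ λ r → (i ≤ k) × (k < i + t) × (r < s k) × (x ≡ val (P k + r))
    ∈middle {x} mx with ∈⇒index middle mx
    ... | p , pl , e with locate Run.shiftedRun p (subst (p <_) (length-concat Run.shiftedRun) pl)
    ...   | k , r , lk , lr , refl = i + k , r , m≤m+n i k , +-monoʳ-< i kt , lr′ ,
            trans (sym e) (trans (!-concat Run.shiftedRun k r lk lr) (trans (cong (_! r) (Run.blk-shiftedRun k kt))
              (trans (!-map _ (blk αs (i + k)) r lr′) (sym (val-block (i + k) r (Run.i+k<m k kt) lr′)))))
      where
      kt : k < t
      kt = subst (k <_) Run.length-shiftedRun lk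
      lr′ : r < s (i + k)
      lr′ = subst (r <_) (trans (cong length (Run.blk-shiftedRun k kt)) (length-map _ (blk αs (i + k)))) lr

    ∈shiftedγR : ∀ {x} → x ∈ shiftedγR → (0 < l') × (Σ ℕ λ r → (r < l') × (r < s (i + t)) × (x ≡ val (P (i + t) + r)))
    ∈shiftedγR {x} mx with right-end
    ... | inj₁ (refl , _) with () ← mx
    ... | inj₂ (_ , l'>0 , _ , _) with ∈-map⁻ (O (i + t) +_) mx
    ...   | y , my , refl with ∈-slice⁻ (blk αs (i + t)) 0 l' (proj₁ γR-interval) my
    ...     | p , pl , sp , e = l'>0 , p , pl , sp ,
               trans (cong (O (i + t) +_) (sym e)) (sym (val-block (i + t) p (i+t<m l'>0) sp))

    module Oriented (d : Direction) (dir : σ ! k0 ≺⟨ d ⟩ σ ! k1) where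

      before-γL : ∀ ro → ro < r0 → ∀ {q} → Inθ q → val (P k0 + ro) ≺⟨ d ⟩ val q
      before-γL ro lt tq = outside-before d (position-<N k0 ro k0<m ros) (before-γL-outside ro lt) (proj₂ (proj₂ k1-meets)) tq
                             (block-≺ d k0 k1 ro r1 k0<m k1<m ros r1<s dir)
        where
        ros : ro < s k0
        ros = <-trans lt r0<s

      after-γR : (lp : 0 < l') → ∀ ro → l' ≤ ro → ro < s (i + t) → ∀ {q} → Inθ q → val q ≺⟨ d ⟩ val (P (i + t) + ro)
      after-γR lp ro le lt tq = outside-after d (position-<N (i + t) ro (i+t<m lp) lt) (after-γR-outside ro le) (proj₂ (proj₂ k0-meets)) tq
        (block-≺ d k0 (i + t) r0 ro k0<m (i+t<m lp) r0<s lt (subst (λ v → σ ! k0 ≺⟨ d ⟩ σ ! v) (sym (proj₁ (right-part lp))) dir))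

      k0-first : 0 < l → ∀ k r r' → k < m → ¬ k0 ≡ k → r < s k0 → r' < s k → Inθ (P k + r') → val (P k0 + r) ≺⟨ d ⟩ val (P k + r')
      k0-first lp k r r' lk ne lr lr' th with left-part lp
      ... | _ , refl , c>0 , _ = block-≺ d k0 k r r' k0<m lk lr lr'
              (block-cmp≺ d k0 k 0 r' k0<m lk (≤-trans (s≤s z≤n) r0<s) lr' ne (before-γL 0 c>0 th))

      i+t-last : (lp : 0 < l') → ∀ k r r' → k < m → ¬ k ≡ i + t → r < s k → r' < s (i + t) → Inθ (P k + r) →
                 val (P k + r) ≺⟨ d ⟩ val (P (i + t) + r')
      i+t-last lp k r r' lk ne lr lr' th = block-≺ d k (i + t) r r' lk (i+t<m lp) lr lr'
        (block-cmp≺ d k (i + t) r l' lk (i+t<m lp) lr (proj₂ (right-part lp)) ne (after-γR lp l' ≤-refl (proj₂ (right-part lp)) th))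

      γL≺middle : ∀ {x y} → x ∈ shiftedγL → y ∈ middle → x ≺⟨ d ⟩ y
      γL≺middle mx my with ∈shiftedγL mx | ∈middle my
      ... | lp , r , rs , _ , refl | k , r' , ik , kt , r's , refl with left-part lp
      ...   | refl , _ = k0-first lp k r r' (<-≤-trans kt i+t≤m) (<⇒≢ ik) rs r's (middle-in-θ k r' ik kt r's)

      γL≺γR : ∀ {x y} → x ∈ shiftedγL → y ∈ shiftedγR → x ≺⟨ d ⟩ y
      γL≺γR mx my with ∈shiftedγL mx | ∈shiftedγR my
      ... | lp , r , rs , _ , refl | lp' , r' , r'l , r's , refl =
        k0-first lp (i + t) r r' (i+t<m lp') (λ e → <⇒≢ k0<k1 (trans e (proj₁ (right-part lp')))) rs r's (γR-in-θ r' r'l)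

      middle≺γR : ∀ {x y} → x ∈ middle → y ∈ shiftedγR → x ≺⟨ d ⟩ y
      middle≺γR mx my with ∈middle mx | ∈shiftedγR my
      ... | k , r , ik , kt , rs , refl | lp' , r' , _ , r's , refl =
        i+t-last lp' k r r' (<-≤-trans kt i+t≤m) (<⇒≢ kt) rs r's (middle-in-θ k r ik kt rs)

      θ-pattern : std (slice π a n) ≡ std γL ⊙⟨ d ⟩ inflate Run.τ Run.run ⊙⟨ d ⟩ std γR
      θ-pattern = begin
          std (slice π a n)
        ≡⟨ cong std θ-entries ⟩
          std ((shiftedγL ++ middle) ++ shiftedγR)
        ≡⟨ std-join d (shiftedγL ++ middle) shiftedγR first-two≺γR ⟩
          std (shiftedγL ++ middle) ⊙⟨ d ⟩ std shiftedγR
        ≡⟨ cong (λ u → u ⊙⟨ d ⟩ std shiftedγR) (std-join d shiftedγL middle γL≺middle) ⟩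
          std shiftedγL ⊙⟨ d ⟩ std middle ⊙⟨ d ⟩ std shiftedγR
        ≡⟨ cong₂ (λ u v → u ⊙⟨ d ⟩ std middle ⊙⟨ d ⟩ v) (std-shift _ γL) (std-shift _ γR) ⟩
          std γL ⊙⟨ d ⟩ std middle ⊙⟨ d ⟩ std γR
        ≡⟨ cong (λ u → std γL ⊙⟨ d ⟩ u ⊙⟨ d ⟩ std γR) Run.run-pattern ⟩
          std γL ⊙⟨ d ⟩ inflate Run.τ Run.run ⊙⟨ d ⟩ std γR ∎
        where
        open ≡-Reasoning
        first-two≺γR : ∀ {x y} → x ∈ shiftedγL ++ middle → y ∈ shiftedγR → x ≺⟨ d ⟩ y
        first-two≺γR mx my with ∈-++⁻ shiftedγL mx
        ... | inj₁ h = γL≺γR h my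
        ... | inj₂ h = middle≺γR h my

      left-window : 0 < l → IsInterval σ (i ∸ 1) (suc t)
      left-window lp with left-part lp
      ... | refl , refl , _ , _ = window , window-contig k0 (suc t) window meets covers
        where
        window : k0 + suc t ≤ m
        window = ≤-trans (≤-reflexive (+-suc k0 t)) i+t≤m
        meets : ∀ k → k0 ≤ k → k < k0 + suc t → Meetsθ k
        meets k lo hi with m≤n⇒m<n∨m≡n lo
        ... | inj₂ refl = k0-meets
        ... | inj₁ lt = middle-meets k lt (subst (k <_) (+-suc k0 t) hi)
        covers : ∀ k → suc k0 ≤ k → k < suc k0 + t → (k0 ≤ k) × (k < k0 + suc t)
        covers k lo hi = <⇒≤ lo , subst (k <_) (sym (+-suc k0 t)) hi

      left-window-pattern : 0 < l → std (slice σ (i ∸ 1) (suc t)) ≡ (0 ∷ []) ⊙⟨ d ⟩ Run.τ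
      left-window-pattern lp with left-part lp
      ... | refl , refl , c>0 , _ = trans (cong std (slice-cons σ k0 t k0<m)) (std-cons d (σ ! k0) _ k0≺)
        where
        k0≺ : ∀ {y} → y ∈ slice σ (suc k0) t → σ ! k0 ≺⟨ d ⟩ y
        k0≺ my with ∈-slice⁻ σ (suc k0) t i+t≤m my
        ... | p , pt , pm , refl = block-cmp≺ d k0 (suc k0 + p) 0 0 k0<m pm (≤-trans (s≤s z≤n) r0<s) (s≥1 _ pm) (<⇒≢ (s≤s (m≤m+n k0 p)))
               (before-γL 0 c>0 (middle-in-θ (suc k0 + p) 0 (m≤m+n _ p) (+-monoʳ-< (suc k0) pt) (s≥1 _ pm)))

      left-suffix : 0 < l → SuffixAt d (blk αs (i ∸ 1)) c l
      left-suffix lp with left-part lp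
      ... | refl , refl , _ , cl = cl , split-pattern d (blk αs k0) r0 (α-perm k0 k0<m) (<⇒≤ r0<s) ordered
        where
        ordered : ∀ p q → p < r0 → r0 + q < s k0 → blk αs k0 ! p ≺⟨ d ⟩ blk αs k0 ! (r0 + q)
        ordered p q pc qs = within-block d k0 p (r0 + q) k0<m (<-trans pc r0<s) qs
          (before-γL p pc (γL-in-θ lp q (+-cancelˡ-< r0 q l (subst (r0 + q <_) (sym cl) qs))))

      right-window : 0 < l' → IsInterval σ i (suc t)
      right-window lp = window , window-contig i (suc t) window meets covers
        where
        window : i + suc t ≤ m
        window = ≤-trans (≤-reflexive (+-suc i t)) (i+t<m lp)
        meets : ∀ k → i ≤ k → k < i + suc t → Meetsθ k
        meets k lo hi with m≤n⇒m<n∨m≡n (≤-pred (subst (k <_) (+-suc i t) hi))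
        ... | inj₂ refl = right-meets lp
        ... | inj₁ lt = middle-meets k lo lt
        covers : ∀ k → i ≤ k → k < i + t → (i ≤ k) × (k < i + suc t)
        covers k lo hi = lo , <-≤-trans hi (+-monoʳ-≤ i (n≤1+n t))

      right-window-pattern : 0 < l' → std (slice σ i (suc t)) ≡ Run.τ ⊙⟨ d ⟩ (0 ∷ [])
      right-window-pattern lp = trans (cong std (slice-snoc σ i t (i+t<m lp))) (std-snoc d _ (σ ! (i + t)) ≺i+t)
        where
        ≺i+t : ∀ {x} → x ∈ slice σ i t → x ≺⟨ d ⟩ σ ! (i + t)
        ≺i+t mx with ∈-slice⁻ σ i t i+t≤m mx
        ... | p , pt , pm , refl = block-cmp≺ d (i + p) (i + t) 0 l' pm (i+t<m lp) (s≥1 _ pm) (proj₂ (right-part lp)) (<⇒≢ (+-monoʳ-< i pt))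
               (after-γR lp l' ≤-refl (proj₂ (right-part lp)) (middle-in-θ (i + p) 0 (m≤m+n i p) (+-monoʳ-< i pt) (s≥1 _ pm)))

      right-prefix : 0 < l' → PrefixAt d (blk αs (i + t)) 0 l'
      right-prefix lp = refl , split-pattern d (blk αs (i + t)) l' (α-perm (i + t) (i+t<m lp)) (<⇒≤ (proj₂ (right-part lp))) ordered
        where
        ordered : ∀ p q → p < l' → l' + q < s (i + t) → blk αs (i + t) ! p ≺⟨ d ⟩ blk αs (i + t) ! (l' + q)
        ordered p q pl qs = within-block d (i + t) p (l' + q) (i+t<m lp) (<-trans pl (proj₂ (right-part lp))) qs
          (after-γR lp (l' + q) (m≤m+n l' q) qs (γR-in-θ p pl))

      case : DirCase d σ αs a n i t c l 0 l'
      case = θ-pattern , (λ lp → left-window lp , left-window-pattern lp , left-suffix lp)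
                       , (λ lp → right-window lp , right-window-pattern lp , right-prefix lp)

  conclusion : Conclusion σ αs a n
  conclusion with direction
  ... | d , dir =
    i , t , c , l , 0 , l' , i+t≤m , middle-interval , γL-interval , γL-nonempty⇒1≤i , γR-interval , i+t<m ,
    θ-cover , DirCase⇒Case d {σ} {αs} {a} {n} {i} {t} {c} {l} {0} {l'} (Oriented.case d dir)
    where
    open WithShape shape
    open Shape shape

proposition2p2 :
    (σ : List ℕ) (αs : List (List ℕ)) →
    IsPerm σ → length αs ≡ length σ →
    All (λ α → IsPerm α × (1 ≤ length α)) αs →
    (a n : ℕ) → IsInterval (inflate σ αs) a n →
    ¬ (Σ ℕ λ k → (k < length σ)
         × (∀ p → InRange a n p → InRange (start αs k) (length (blk αs k)) p)) →
    Σ ℕ λ i → Σ ℕ λ t → Σ ℕ λ c → Σ ℕ λ l → Σ ℕ λ c' → Σ ℕ λ l' →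
      (i + t ≤ length σ) × IsInterval σ i t
      × IsInterval (blk αs (i ∸ 1)) c l × (0 < l → 1 ≤ i)
      × IsInterval (blk αs (i + t)) c' l' × (0 < l' → i + t < length σ)
      × (∀ p → (InRange a n p →
                  InRange (start αs (i ∸ 1) + c) l p
                  ⊎ InRange (start αs i) (start αs (i + t) ∸ start αs i) p
                  ⊎ InRange (start αs (i + t) + c') l' p)
             × (InRange (start αs (i ∸ 1) + c) l p
                  ⊎ InRange (start αs i) (start αs (i + t) ∸ start αs i) p
                  ⊎ InRange (start αs (i + t) + c') l' p → InRange a n p))
      × (SumCase σ αs a n i t c l c' l' ⊎ SkewCase σ αs a n i t c l c' l')
proposition2p2 σ αs _ _ _ a zero _ _ = empty-conclusion σ αs a
proposition2p2 σ αs σ-perm length-αs αs-perms a (suc n') θ-interval not-in-one-block =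
  Main.conclusion σ αs σ-perm length-αs αs-perms a n' θ-interval not-in-one-block
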